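{- Let $h \geq 2$ and let $T_h$ be the perfect binary tree of height $h$. Write $h = 4m + r$ with $m \geq 0$ an integer and $1 \leq r \leq 4$. Then \[ \alpha_b(T_h) = 3 \cdot 2^{r-1} \cdot \frac{16^{m+1}-1}{15} + b_r, \] where $b_1 = 1$, $b_2 = b_3 = 0$ and $b_4 = 3$.
   Context: All graphs are finite, simple, undirected and connected with at least two vertices. For a graph $G$, $d(u,v)$ is the distance, $\mathrm{ecc}(v)$ the eccentricity of $v$, and $\mathrm{diam}(G)$ the diameter. A broadcast on $G$ is a function $f: V(G) \to \{0,1,\dots,\mathrm{diam}(G)\}$ with $f(v) \leq \mathrm{ecc}(v)$ for every $v$; its weight is $f(V) = \sum_{v} f(v)$. A vertex $v$ is broadcasting if $f(v) > 0$. A vertex $u$ hears a broadcasting vertex $v$ if $d(u,v) \leq f(v)$. A broadcast is independent if every broadcasting vertex hears only itself. The broadcast independence number $\alpha_b(G)$ is the maximum weight of an independent broadcast on $G$. The perfect binary tree $T_h$ of height $h$ is the rooted tree in which every non-leaf vertex has exactly $2$ children and all leaves are at distance $h$ from the root. -}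

module Defs where

open import Data.Nat using (ℕ; zero; suc; _+_; _*_; _∸_; _^_; _≤_; _<_)
open import Data.Bool using (Bool; true; false)
open import Data.List using (List; []; _∷_; _++_; map; length; concatMap; upTo)
open import Data.Nat.ListAction using (sum)
open import Data.Product using (Σ; ∃; _×_; _,_)
open import Relation.Binary.PropositionalEquality using (_≡_)

-- Vertices of the perfect binary tree T_h: binary words of length ≤ h.
-- The word b ∷ u is a child of u (the root is []).
IsVertex : ℕ → List Bool → Set
IsVertex h u = length u ≤ h

data Adj (h : ℕ) : List Bool → List Bool → Set where
  down : ∀ {u} (b : Bool) → length (b ∷ u) ≤ h → Adj h u (b ∷ u)
  up   : ∀ {u} (b : Bool) → length (b ∷ u) ≤ h → Adj h (b ∷ u) u

data Walk (h : ℕ) : ℕ → List Bool → List Bool → Set where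
  here : ∀ {u} → Walk h 0 u u
  step : ∀ {k u w v} → Adj h u w → Walk h k w v → Walk h (suc k) u v

IsDist : ℕ → List Bool → List Bool → ℕ → Set
IsDist h u v d = Walk h d u v × (∀ k → Walk h k u v → d ≤ k)

wordsOfLength : ℕ → List (List Bool)
wordsOfLength zero = [] ∷ []
wordsOfLength (suc k) = map (false ∷_) (wordsOfLength k) ++ map (true ∷_) (wordsOfLength k)

vertices : ℕ → List (List Bool)
vertices h = concatMap wordsOfLength (upTo (suc h))

weight : ℕ → (List Bool → ℕ) → ℕ
weight h f = sum (map f (vertices h))

-- f(v) ≤ ecc(v): some vertex u of T_h is at distance ≥ f(v) from v.
-- (This also gives f(v) ≤ diam(T_h), so f maps into {0,…,diam}.)
IsBroadcast : ℕ → (List Bool → ℕ) → Set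
IsBroadcast h f = ∀ v → IsVertex h v →
  Σ (List Bool) λ u → IsVertex h u × Σ ℕ λ d → IsDist h u v d × f v ≤ d

Broadcasting : (List Bool → ℕ) → List Bool → Set
Broadcasting f v = 0 < f v

Hears : ℕ → (List Bool → ℕ) → List Bool → List Bool → Set
Hears h f u v = Broadcasting f v × Σ ℕ λ d → IsDist h u v d × d ≤ f v

IsIndependent : ℕ → (List Bool → ℕ) → Set
IsIndependent h f = ∀ u v → IsVertex h u → IsVertex h v →
  Broadcasting f u → Hears h f u v → u ≡ v

IsIndepBroadcast : ℕ → (List Bool → ℕ) → Set
IsIndepBroadcast h f = IsBroadcast h f × IsIndependent h f

IsAlphaB : ℕ → ℕ → Set
IsAlphaB h N =
  (Σ (List Bool → ℕ) λ f → IsIndepBroadcast h f × weight h f ≡ N)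
  × (∀ f → IsIndepBroadcast h f → weight h f ≤ N)

bTerm : ℕ → ℕ
bTerm 1 = 1
bTerm 4 = 3
bTerm _ = 0

-- Lower bound: for h = 4 m + suc k, let every left child whose parent has depth d ≥ 1 with
-- d ≡ k (mod 4) broadcast 3, and let the root broadcast 4 if k = 0 and 3 if k = 3. Two such left
-- children on one level are at even distance and never siblings, hence at distance ≥ 4, and distinct
-- levels are 4 apart; the root is too far above the first level to be heard. Summing level by level
-- gives 3 · 2^k · (1 + 16 + ⋯ + 16^m), corrected by b_r for the root.
--
-- Upper bound: induction over the subtrees of T_h. A broadcast on a subtree of height t is summarised
-- by its reach (how far above the subtree's root it is heard), the least depth of a broadcasting
-- vertex and its weight. Of independence only the constraints between the two child subtrees and
-- the root are needed, and a case analysis of these joins shows that the weight never exceeds that of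
-- a lone broadcasting vertex or the value of one of a few extremal profiles: 2^k (2 C j + 3) or
-- 2^(k+1) (C j + 1) when t = 4 j + k + 1, and C J + f or 2 C J + 4 when the root broadcasts. For T_h
-- itself the eccentricity bound keeps the reach at most 2h, and every value then allowed is at most
-- the claimed α_b(T_h).

module Submission where

open import Defs
open import Data.Nat using (ℕ; zero; suc; _+_; _*_; _^_; _∸_; _≤_; _<_; z≤n; s≤s; _⊔_; _⊓_; _≡ᵇ_)
open import Data.Nat.Properties
open import Data.Nat.DivMod using (_/_; m*n/n≡m)
open import Data.Nat.ListAction using (sum)
open import Data.Nat.ListAction.Properties using (sum-++)
open import Data.Nat.Tactic.RingSolver using (solve-∀)
open import Algebra.Properties.CommutativeSemigroup +-commutativeSemigroup using (interchange)
open import Data.Bool using (Bool; true; false; not; if_then_else_)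
open import Data.Bool.Properties using (not-¬; not-involutive; T-≡)
open import Data.List using (List; []; _∷_; _++_; _∷ʳ_; length; map; applyUpTo; upTo; concatMap; replicate)
open import Data.List.Properties
  using (length-++; ++-assoc; ++-identityʳ; ++-cancelʳ; ∷ʳ-injectiveʳ; map-++; map-∘; length-replicate)
open import Data.Product using (Σ; ∃-syntax; _×_; _,_; proj₁; proj₂)
open import Data.Sum using (_⊎_; inj₁; inj₂)
open import Data.Empty using (⊥; ⊥-elim)
open import Data.Unit using (⊤; tt)
open import Function using (_∘_)
open import Function.Bundles using (Equivalence)
open import Relation.Nullary using (¬_; Dec; yes; no)
open import Relation.Binary.Definitions using (tri<; tri≈; tri>)
open import Relation.Binary.PropositionalEquality

-- Distances in T_h

length-∷ʳ : ∀ (w : List Bool) b → length (w ∷ʳ b) ≡ suc (length w)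
length-∷ʳ []      b = refl
length-∷ʳ (c ∷ w) b = cong suc (length-∷ʳ w b)

walk-depthˡ : ∀ {h k u v} → Walk h k u v → length u ≤ k + length v
walk-depthˡ here                = ≤-refl
walk-depthˡ (step (down b p) r) = m≤n⇒m≤1+n (<⇒≤ (walk-depthˡ r))
walk-depthˡ (step (up b p) r)   = s≤s (walk-depthˡ r)

walk-depthʳ : ∀ {h k u v} → Walk h k u v → length v ≤ k + length u
walk-depthʳ here = ≤-refl
walk-depthʳ {k = suc k} {u = u} (step (down b p) r) =
  ≤-trans (walk-depthʳ r) (≤-reflexive (+-suc k (length u)))
walk-depthʳ {k = suc k} (step (up {u = u} b p) r) =
  ≤-trans (walk-depthʳ r) (m≤n⇒m≤1+n (+-monoʳ-≤ k (n≤1+n (length u))))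

walk-∷ʳ : ∀ {h k u w v} → Walk h k u w → Adj h w v → Walk h (suc k) u v
walk-∷ʳ here       a = step a here
walk-∷ʳ (step a r) b = step a (walk-∷ʳ r b)

walk-++ : ∀ {h k l u w v} → Walk h k u w → Walk h l w v → Walk h (k + l) u v
walk-++ here       q = q
walk-++ (step a r) q = step a (walk-++ r q)

walk-up : ∀ {h} (w x : List Bool) → length (w ++ x) ≤ h → Walk h (length w) (w ++ x) x
walk-up []      x p = here
walk-up (b ∷ w) x p = step (up b p) (walk-up w x (<⇒≤ p))

walk-down : ∀ {h} (w x : List Bool) → length (w ++ x) ≤ h → Walk h (length w) x (w ++ x)
walk-down []      x p = here
walk-down (b ∷ w) x p = walk-∷ʳ (walk-down w x (<⇒≤ p)) (down b p)

-- (w ∷ʳ b) ++ x and (w' ∷ʳ b') ++ x lie below distinct children of x, so every walk between them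
-- passes through x.
walk-across : ∀ {h k u v} → Walk h k u v → ∀ w b w' b' x → ¬ b ≡ b' →
  u ≡ (w ∷ʳ b) ++ x → v ≡ (w' ∷ʳ b') ++ x → suc (suc (length w + length w')) ≤ k
walk-across here w b w' b' x b≢b' refl v≡ =
  ⊥-elim (b≢b' (∷ʳ-injectiveʳ w w' (++-cancelʳ x (w ∷ʳ b) (w' ∷ʳ b') v≡)))
walk-across (step (down c p) r) w b w' b' x b≢b' refl v≡ =
  m≤n⇒m≤1+n (≤-trans (s≤s (s≤s (n≤1+n _))) (walk-across r (c ∷ w) b w' b' x b≢b' refl v≡))
walk-across {k = suc k} (step (up c p) r) [] b w' b' x b≢b' refl refl =
  s≤s (+-cancelʳ-≤ (length x) (suc (length w')) k (≤-trans (≤-reflexive depth) (walk-depthʳ r)))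
  where
  depth : suc (length w') + length x ≡ length ((w' ∷ʳ b') ++ x)
  depth = sym (trans (length-++ (w' ∷ʳ b')) (cong (_+ length x) (length-∷ʳ w' b')))
walk-across (step (up c p) r) (d ∷ w) b w' b' x b≢b' refl v≡ =
  s≤s (walk-across r w b w' b' x b≢b' refl v≡)

dist-up : ∀ {h} (w x : List Bool) → length (w ++ x) ≤ h → IsDist h (w ++ x) x (length w)
dist-up w x p = walk-up w x p , λ k q →
  +-cancelʳ-≤ (length x) (length w) k (≤-trans (≤-reflexive (sym (length-++ w))) (walk-depthˡ q))

dist-down : ∀ {h} (w x : List Bool) → length (w ++ x) ≤ h → IsDist h x (w ++ x) (length w)
dist-down w x p = walk-down w x p , λ k q →
  +-cancelʳ-≤ (length x) (length w) k (≤-trans (≤-reflexive (sym (length-++ w))) (walk-depthʳ q))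

dist-toRoot : ∀ {h} (u : List Bool) → length u ≤ h → IsDist h u [] (length u)
dist-toRoot {h} u p = subst (λ v → IsDist h v [] (length u)) (++-identityʳ u)
  (dist-up u [] (subst (λ v → length v ≤ h) (sym (++-identityʳ u)) p))

dist-fromRoot : ∀ {h} (u : List Bool) → length u ≤ h → IsDist h [] u (length u)
dist-fromRoot {h} u p = subst (λ v → IsDist h [] v (length u)) (++-identityʳ u)
  (dist-down u [] (subst (λ v → length v ≤ h) (sym (++-identityʳ u)) p))

dist-across : ∀ {h} (w w' x : List Bool) b b' → ¬ b ≡ b' →
  length ((w ∷ʳ b) ++ x) ≤ h → length ((w' ∷ʳ b') ++ x) ≤ h →
  IsDist h ((w ∷ʳ b) ++ x) ((w' ∷ʳ b') ++ x) (suc (suc (length w + length w')))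
dist-across {h} w w' x b b' b≢b' p p' =
  subst (λ n → Walk h n ((w ∷ʳ b) ++ x) ((w' ∷ʳ b') ++ x)) lengths
    (walk-++ (walk-up (w ∷ʳ b) x p) (walk-down (w' ∷ʳ b') x p')) ,
  λ k q → walk-across q w b w' b' x b≢b' refl refl
  where
  lengths : length (w ∷ʳ b) + length (w' ∷ʳ b') ≡ suc (suc (length w + length w'))
  lengths rewrite length-∷ʳ w b | length-∷ʳ w' b' = cong suc (+-suc (length w) (length w'))

independent⇒value<dist : ∀ {h f u v d} → IsIndependent h f → IsVertex h u → IsVertex h v →
  0 < f u → 0 < f v → IsDist h u v d → 0 < d → f v < d
independent⇒value<dist {h} {f} {u} {v} {d} ind iu iv fu fv dist d>0 with d ≤? f v
... | no d≰fv = ≰⇒> d≰fv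
... | yes d≤fv = ⊥-elim (<-irrefl refl (≤-trans d>0 (proj₂ dist 0 (subst (Walk h 0 u) u≡v here))))
  where
  u≡v : u ≡ v
  u≡v = ind u v iu iv fu (fv , d , dist , d≤fv)

infixl 6 _↓_

-- Weights as sums over subtrees

-- A function g on the subtree rooted at x sees its vertex w ++ x as w; g ↓ b is g on the subtree
-- rooted at the child b ∷ x, whose vertex w ++ b ∷ x is w ∷ʳ b to g.
_↓_ : (List Bool → ℕ) → Bool → List Bool → ℕ
(g ↓ b) w = g (w ∷ʳ b)

levelSum : ℕ → (List Bool → ℕ) → ℕ
levelSum k g = sum (map g (wordsOfLength k))

sum-map-++ : ∀ (g : List Bool → ℕ) xs ys → sum (map g (xs ++ ys)) ≡ sum (map g xs) + sum (map g ys)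
sum-map-++ g xs ys = trans (cong sum (map-++ g xs ys)) (sum-++ (map g xs) (map g ys))

levelSum-∷ : ∀ k g →
  levelSum (suc k) g ≡ levelSum k (λ w → g (false ∷ w)) + levelSum k (λ w → g (true ∷ w))
levelSum-∷ k g = trans (sum-map-++ g (map (false ∷_) ws) (map (true ∷_) ws))
  (cong₂ _+_ (cong sum (sym (map-∘ ws))) (cong sum (sym (map-∘ ws))))
  where
  ws : List (List Bool)
  ws = wordsOfLength k

levelSum-↓ : ∀ k g → levelSum (suc k) g ≡ levelSum k (g ↓ false) + levelSum k (g ↓ true)
levelSum-↓ zero    g = cong₂ _+_ (sym (+-identityʳ (g (false ∷ [])))) refl
levelSum-↓ (suc k) g = begin
  levelSum (suc (suc k)) g
    ≡⟨ levelSum-∷ (suc k) g ⟩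
  levelSum (suc k) g₀ + levelSum (suc k) g₁
    ≡⟨ cong₂ _+_ (levelSum-↓ k g₀) (levelSum-↓ k g₁) ⟩
  (levelSum k (g₀ ↓ false) + levelSum k (g₀ ↓ true)) + (levelSum k (g₁ ↓ false) + levelSum k (g₁ ↓ true))
    ≡⟨ interchange (levelSum k (g₀ ↓ false)) _ _ _ ⟩
  (levelSum k (g₀ ↓ false) + levelSum k (g₁ ↓ false)) + (levelSum k (g₀ ↓ true) + levelSum k (g₁ ↓ true))
    ≡⟨ sym (cong₂ _+_ (levelSum-∷ k (g ↓ false)) (levelSum-∷ k (g ↓ true))) ⟩
  levelSum (suc k) (g ↓ false) + levelSum (suc k) (g ↓ true) ∎
  where
  open ≡-Reasoning
  g₀ g₁ : List Bool → ℕ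
  g₀ w = g (false ∷ w)
  g₁ w = g (true ∷ w)

sumBelow : ℕ → (ℕ → ℕ) → ℕ
sumBelow zero    F = 0
sumBelow (suc n) F = F 0 + sumBelow n (λ k → F (suc k))

sumBelow-cong : ∀ n {F G : ℕ → ℕ} → (∀ k → F k ≡ G k) → sumBelow n F ≡ sumBelow n G
sumBelow-cong zero    F≡G = refl
sumBelow-cong (suc n) F≡G = cong₂ _+_ (F≡G 0) (sumBelow-cong n (λ k → F≡G (suc k)))

sumBelow-+ : ∀ n (F G : ℕ → ℕ) → sumBelow n (λ k → F k + G k) ≡ sumBelow n F + sumBelow n G
sumBelow-+ zero    F G = refl
sumBelow-+ (suc n) F G = trans (cong (F 0 + G 0 +_) (sumBelow-+ n (λ k → F (suc k)) (λ k → G (suc k))))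
  (interchange (F 0) (G 0) _ _)

sumBelow-+-split : ∀ a b (F : ℕ → ℕ) → sumBelow (a + b) F ≡ sumBelow a F + sumBelow b (λ i → F (a + i))
sumBelow-+-split zero    b F = refl
sumBelow-+-split (suc a) b F =
  trans (cong (F 0 +_) (sumBelow-+-split a b (λ i → F (suc i)))) (sym (+-assoc (F 0) _ _))

sum-applyUpTo : ∀ n (F f : ℕ → ℕ) → sum (map F (applyUpTo f n)) ≡ sumBelow n (λ k → F (f k))
sum-applyUpTo zero    F f = refl
sum-applyUpTo (suc n) F f = cong (F (f 0) +_) (sum-applyUpTo n F (λ k → f (suc k)))

sum-concatMap-wordsOfLength : ∀ (g : List Bool → ℕ) ks →
  sum (map g (concatMap wordsOfLength ks)) ≡ sum (map (λ k → levelSum k g) ks)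
sum-concatMap-wordsOfLength g []       = refl
sum-concatMap-wordsOfLength g (k ∷ ks) =
  trans (sum-map-++ g (wordsOfLength k) (concatMap wordsOfLength ks))
  (cong (levelSum k g +_) (sum-concatMap-wordsOfLength g ks))

weight≡sumBelow-levelSum : ∀ h f → weight h f ≡ sumBelow (suc h) (λ k → levelSum k f)
weight≡sumBelow-levelSum h f = trans (sum-concatMap-wordsOfLength f (upTo (suc h)))
  (sum-applyUpTo (suc h) (λ k → levelSum k f) (λ k → k))

subtreeWeight : ℕ → (List Bool → ℕ) → ℕ
subtreeWeight zero    g = g []
subtreeWeight (suc t) g = g [] + subtreeWeight t (g ↓ false) + subtreeWeight t (g ↓ true)

subtreeWeight≡sumBelow-levelSum : ∀ t g → subtreeWeight t g ≡ sumBelow (suc t) (λ k → levelSum k g)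
subtreeWeight≡sumBelow-levelSum zero    g = sym (trans (+-identityʳ _) (+-identityʳ _))
subtreeWeight≡sumBelow-levelSum (suc t) g = begin
  g [] + subtreeWeight t g₀ + subtreeWeight t g₁
    ≡⟨ cong₂ (λ a b → g [] + a + b) (subtreeWeight≡sumBelow-levelSum t g₀)
                                     (subtreeWeight≡sumBelow-levelSum t g₁) ⟩
  g [] + levels g₀ + levels g₁
    ≡⟨ +-assoc (g []) _ _ ⟩
  g [] + (levels g₀ + levels g₁)
    ≡⟨ cong₂ _+_ (sym (+-identityʳ (g []))) (sym (sumBelow-+ (suc t) (λ k → levelSum k g₀) (λ k → levelSum k g₁))) ⟩
  (g [] + 0) + sumBelow (suc t) (λ k → levelSum k g₀ + levelSum k g₁)
    ≡⟨ cong ((g [] + 0) +_) (sumBelow-cong (suc t) (λ k → sym (levelSum-↓ k g))) ⟩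
  (g [] + 0) + sumBelow (suc t) (λ k → levelSum (suc k) g) ∎
  where
  open ≡-Reasoning
  g₀ g₁ : List Bool → ℕ
  g₀ = g ↓ false
  g₁ = g ↓ true
  levels : (List Bool → ℕ) → ℕ
  levels g' = sumBelow (suc t) (λ k → levelSum k g')

weight≡subtreeWeight : ∀ h f → weight h f ≡ subtreeWeight h f
weight≡subtreeWeight h f = trans (weight≡sumBelow-levelSum h f) (sym (subtreeWeight≡sumBelow-levelSum h f))

-- Reach and least broadcasting depth of a subtree

ownReach : ℕ → ℕ → ℕ
ownReach zero    c = 0
ownReach (suc n) c = suc n + c

ifSilent : ℕ → ℕ → ℕ
ifSilent zero    k = k
ifSilent (suc _) k = 0

-- reach t g is the maximum of g w + (t − depth w) over broadcasting w (0 if there is none):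
-- t plus how far above the root of the subtree the broadcasts are heard.
-- minDepth t g is the least depth of a broadcasting vertex (suc t if there is none).
reach : ℕ → (List Bool → ℕ) → ℕ
reach zero    g = ownReach (g []) 0
reach (suc t) g = ownReach (g []) (suc t) ⊔ (reach t (g ↓ false) ⊔ reach t (g ↓ true))

minDepth : ℕ → (List Bool → ℕ) → ℕ
minDepth zero    g = ifSilent (g []) 1
minDepth (suc t) g = ifSilent (g []) (suc (minDepth t (g ↓ false) ⊓ minDepth t (g ↓ true)))

ownReach-pos : ∀ n c → 1 ≤ ownReach n c → 0 < n × ownReach n c ≡ n + c
ownReach-pos (suc n) c _ = s≤s z≤n , refl

ownReach-≤ : ∀ n c k → (0 < n → n + k ≤ c) → ownReach n k ≤ c
ownReach-≤ zero    c k _ = z≤n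
ownReach-≤ (suc n) c k h = h (s≤s z≤n)

minDepth≤suc : ∀ t g → minDepth t g ≤ suc t
minDepth≤suc zero g with g []
... | zero  = ≤-refl
... | suc _ = z≤n
minDepth≤suc (suc t) g with g []
... | zero  = s≤s (≤-trans (m⊓n≤m _ _) (minDepth≤suc t (g ↓ false)))
... | suc _ = z≤n

ownReach≡0 : ∀ n c → ownReach n c ≡ 0 → n ≡ 0
ownReach≡0 zero c _ = refl

reach-suc≡0 : ∀ t g → reach (suc t) g ≡ 0 →
  g [] ≡ 0 × reach t (g ↓ false) ≡ 0 × reach t (g ↓ true) ≡ 0
reach-suc≡0 t g e =
  ownReach≡0 (g []) (suc t) (n≤0⇒n≡0 (m⊔n≤o⇒m≤o (ownReach (g []) (suc t)) _ e≤)) ,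
  n≤0⇒n≡0 (m⊔n≤o⇒m≤o _ _ children≤) , n≤0⇒n≡0 (m⊔n≤o⇒n≤o _ _ children≤)
  where
  e≤ : reach (suc t) g ≤ 0
  e≤ = ≤-reflexive e
  children≤ : reach t (g ↓ false) ⊔ reach t (g ↓ true) ≤ 0
  children≤ = m⊔n≤o⇒n≤o (ownReach (g []) (suc t)) _ e≤

reach≡0⇒subtreeWeight≡0 : ∀ t g → reach t g ≡ 0 → subtreeWeight t g ≡ 0
reach≡0⇒subtreeWeight≡0 zero    g e = ownReach≡0 (g []) 0 e
reach≡0⇒subtreeWeight≡0 (suc t) g e with reach-suc≡0 t g e
... | g[]≡0 , e₀ , e₁ rewrite g[]≡0 =
  cong₂ _+_ (reach≡0⇒subtreeWeight≡0 t _ e₀) (reach≡0⇒subtreeWeight≡0 t _ e₁)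

reach≡0⇒minDepth≡suc : ∀ t g → reach t g ≡ 0 → minDepth t g ≡ suc t
reach≡0⇒minDepth≡suc zero    g e rewrite ownReach≡0 (g []) 0 e = refl
reach≡0⇒minDepth≡suc (suc t) g e with reach-suc≡0 t g e
... | g[]≡0 , e₀ , e₁ rewrite g[]≡0 =
  cong suc (trans (cong₂ _⊓_ (reach≡0⇒minDepth≡suc t _ e₀) (reach≡0⇒minDepth≡suc t _ e₁)) (⊓-idem (suc t)))

length-∷ʳ-≤ : ∀ {t} (w : List Bool) b → length w ≤ t → length (w ∷ʳ b) ≤ suc t
length-∷ʳ-≤ w b l = subst (_≤ _) (sym (length-∷ʳ w b)) (s≤s l)

ReachWitness : ℕ → (List Bool → ℕ) → List Bool → Set
ReachWitness t g w = length w ≤ t × 0 < g w × reach t g + length w ≡ g w + t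

reachWitness-↓ : ∀ {t g b w} → reach (suc t) g ≡ reach t (g ↓ b) →
  ReachWitness t (g ↓ b) w → ReachWitness (suc t) g (w ∷ʳ b)
reachWitness-↓ {b = b} {w} e (l , g>0 , q) = length-∷ʳ-≤ w b l , g>0 ,
  trans (cong₂ _+_ e (length-∷ʳ w b)) (trans (+-suc _ _) (trans (cong suc q) (sym (+-suc _ _))))

reach-attained : ∀ t g → 1 ≤ reach t g → ∃[ w ] ReachWitness t g w
reach-attained zero g p with ownReach-pos (g []) 0 p
... | g>0 , e = [] , z≤n , g>0 , trans (+-identityʳ _) e
reach-attained (suc t) g p
  with ⊔-sel (ownReach (g []) (suc t)) (reach t (g ↓ false) ⊔ reach t (g ↓ true))
... | inj₁ e with ownReach-pos (g []) (suc t) (subst (1 ≤_) e p)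
...   | g>0 , e' = [] , z≤n , g>0 , trans (+-identityʳ _) (trans e e')
reach-attained (suc t) g p | inj₂ e with ⊔-sel (reach t (g ↓ false)) (reach t (g ↓ true))
... | inj₁ e' with reach-attained t (g ↓ false) (subst (1 ≤_) (trans e e') p)
...   | w , wit = w ∷ʳ false , reachWitness-↓ {t} {g} {false} {w} (trans e e') wit
reach-attained (suc t) g p | inj₂ e | inj₂ e'
  with reach-attained t (g ↓ true) (subst (1 ≤_) (trans e e') p)
...   | w , wit = w ∷ʳ true , reachWitness-↓ {t} {g} {true} {w} (trans e e') wit

DepthWitness : ℕ → (List Bool → ℕ) → List Bool → Set
DepthWitness t g w = length w ≤ t × 0 < g w × length w ≡ minDepth t g

depthWitness-↓ : ∀ t g b → minDepth t (g ↓ b) ≤ minDepth t (g ↓ not b) → ∃[ w ] DepthWitness t (g ↓ b) w →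
  ∃[ w ] length w ≤ suc t × 0 < g w × length w ≡ suc (minDepth t (g ↓ false) ⊓ minDepth t (g ↓ true))
depthWitness-↓ t g false le (w , l , g>0 , q) = w ∷ʳ false , length-∷ʳ-≤ w false l , g>0 ,
  trans (length-∷ʳ w false) (cong suc (trans q (sym (m≤n⇒m⊓n≡m le))))
depthWitness-↓ t g true  le (w , l , g>0 , q) = w ∷ʳ true , length-∷ʳ-≤ w true l , g>0 ,
  trans (length-∷ʳ w true) (cong suc (trans q (sym (m≥n⇒m⊓n≡n le))))

¬1≤⇒≡0 : ∀ {r} → ¬ 1 ≤ r → r ≡ 0
¬1≤⇒≡0 r≱1 = n<1⇒n≡0 (≰⇒> r≱1)

minDepth≤minDepth-silent : ∀ t g g' → reach t g' ≡ 0 → minDepth t g ≤ minDepth t g'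
minDepth≤minDepth-silent t g g' e = ≤-trans (minDepth≤suc t g) (≤-reflexive (sym (reach≡0⇒minDepth≡suc t g' e)))

minDepth-attained : ∀ t g → 1 ≤ reach t g → ∃[ w ] DepthWitness t g w
minDepth-attained zero g p with g [] in g[]≡
... | suc n = [] , z≤n , subst (0 <_) (sym g[]≡) (s≤s z≤n) , refl
minDepth-attained (suc t) g p with g [] in g[]≡
... | suc n = [] , z≤n , subst (0 <_) (sym g[]≡) (s≤s z≤n) , refl
... | zero with 1 ≤? reach t (g ↓ false) | 1 ≤? reach t (g ↓ true)
...   | no a  | no b  = ⊥-elim (<-irrefl refl (≤-trans p (≤-reflexive (cong₂ _⊔_ (¬1≤⇒≡0 a) (¬1≤⇒≡0 b)))))
...   | yes a | no b  = depthWitness-↓ t g false (minDepth≤minDepth-silent t _ _ (¬1≤⇒≡0 b)) (minDepth-attained t _ a)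
...   | no a  | yes b = depthWitness-↓ t g true  (minDepth≤minDepth-silent t _ _ (¬1≤⇒≡0 a)) (minDepth-attained t _ b)
...   | yes a | yes b with ≤-total (minDepth t (g ↓ false)) (minDepth t (g ↓ true))
...     | inj₁ le = depthWitness-↓ t g false le (minDepth-attained t _ a)
...     | inj₂ le = depthWitness-↓ t g true le (minDepth-attained t _ b)

minDepth≤height : ∀ t g → 1 ≤ reach t g → minDepth t g ≤ t
minDepth≤height t g p with minDepth-attained t g p
... | w , l , _ , q = ≤-trans (≤-reflexive (sym q)) l

reach-≤ : ∀ t g c → (∀ w → length w ≤ t → 0 < g w → g w + t ≤ c + length w) → reach t g ≤ c
reach-≤ zero g c h = ownReach-≤ (g []) c 0 (λ p → ≤-trans (h [] z≤n p) (≤-reflexive (+-identityʳ c)))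
reach-≤ (suc t) g c h = ⊔-lub (ownReach-≤ (g []) c (suc t) (λ p → ≤-trans (h [] z≤n p) (≤-reflexive (+-identityʳ c))))
  (⊔-lub (reach-≤ t _ c (h↓ false)) (reach-≤ t _ c (h↓ true)))
  where
  h↓ : ∀ b w → length w ≤ t → 0 < (g ↓ b) w → (g ↓ b) w + t ≤ c + length w
  h↓ b w l p = +-cancelʳ-≤ 1 _ _ (begin
    (g ↓ b) w + t + 1          ≡⟨ trans (+-assoc ((g ↓ b) w) t 1) (cong ((g ↓ b) w +_) (+-comm t 1)) ⟩
    (g ↓ b) w + suc t          ≤⟨ h (w ∷ʳ b) (length-∷ʳ-≤ w b l) p ⟩
    c + length (w ∷ʳ b)        ≡⟨ trans (cong (c +_) (length-∷ʳ w b)) (trans (+-suc c _) (+-comm 1 _)) ⟩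
    c + length w + 1           ∎)
    where open ≤-Reasoning

-- suc (suc (length w + length w')) is the distance between the vertices w ∷ʳ b and w' ∷ʳ not b,
-- and suc (length w) the distance from w ∷ʳ b to the root.
CrossIndependent : ℕ → (List Bool → ℕ) → Set
CrossIndependent t g = ∀ b w w' → length w ≤ t → length w' ≤ t →
  0 < (g ↓ b) w → 0 < (g ↓ not b) w' → (g ↓ b) w < suc (suc (length w + length w'))

RootIndependent : ℕ → (List Bool → ℕ) → Set
RootIndependent t g = ∀ b w → length w ≤ t → 0 < g [] → 0 < (g ↓ b) w →
  g [] < suc (length w) × (g ↓ b) w < suc (length w)

SubtreeIndependent : ℕ → (List Bool → ℕ) → Set
SubtreeIndependent zero    g = ⊤
SubtreeIndependent (suc t) g =
  CrossIndependent t g × RootIndependent t g × SubtreeIndependent t (g ↓ false) × SubtreeIndependent t (g ↓ true)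

crossIndependent⇒reach≤ : ∀ t g b → CrossIndependent t g → 1 ≤ reach t (g ↓ b) → 1 ≤ reach t (g ↓ not b) →
  reach t (g ↓ b) ≤ suc (t + minDepth t (g ↓ not b))
crossIndependent⇒reach≤ t g b cross p p'
  with reach-attained t (g ↓ b) p | minDepth-attained t (g ↓ not b) p'
... | w , l , g>0 , q | w' , l' , g'>0 , q' = +-cancelʳ-≤ (length w) _ _ (begin
  reach t (g ↓ b) + length w              ≡⟨ q ⟩
  (g ↓ b) w + t                          ≤⟨ +-monoˡ-≤ t (≤-pred (cross b w w' l l' g>0 g'>0)) ⟩
  suc (length w + length w') + t          ≡⟨ cong (λ d → suc (length w + d) + t) q' ⟩
  suc (length w + minDepth t (g ↓ not b)) + t  ≡⟨ shuffle (length w) _ t ⟩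
  suc (t + minDepth t (g ↓ not b)) + length w  ∎)
  where
  open ≤-Reasoning
  shuffle : ∀ a m t → suc (a + m) + t ≡ suc (t + m) + a
  shuffle = solve-∀

rootIndependent⇒reach≤height : ∀ t g b → RootIndependent t g → 0 < g [] → 1 ≤ reach t (g ↓ b) →
  reach t (g ↓ b) ≤ t
rootIndependent⇒reach≤height t g b rootInd g[]>0 p with reach-attained t (g ↓ b) p
... | w , l , g>0 , q = +-cancelʳ-≤ (length w) _ _ (begin
  reach t (g ↓ b) + length w  ≡⟨ q ⟩
  (g ↓ b) w + t              ≤⟨ +-monoˡ-≤ t (≤-pred (proj₂ (rootInd b w l g[]>0 g>0))) ⟩
  length w + t                ≡⟨ +-comm (length w) t ⟩
  t + length w                ∎)
  where open ≤-Reasoning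

rootIndependent⇒root≤minDepth : ∀ t g b → RootIndependent t g → 0 < g [] → 1 ≤ reach t (g ↓ b) →
  g [] ≤ minDepth t (g ↓ b)
rootIndependent⇒root≤minDepth t g b rootInd g[]>0 p with minDepth-attained t (g ↓ b) p
... | w , l , g>0 , q = ≤-trans (≤-pred (proj₁ (rootInd b w l g[]>0 g>0))) (≤-reflexive q)

isVertex-∷ʳ-++ : ∀ {h t} (w : List Bool) b x → length w ≤ t → length x + suc t ≤ h →
  IsVertex h ((w ∷ʳ b) ++ x)
isVertex-∷ʳ-++ {h} {t} w b x lw lx = begin
  length ((w ∷ʳ b) ++ x)      ≡⟨ trans (length-++ (w ∷ʳ b)) (cong (_+ length x) (length-∷ʳ w b)) ⟩
  suc (length w) + length x   ≤⟨ +-monoˡ-≤ (length x) (s≤s lw) ⟩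
  suc t + length x            ≡⟨ +-comm (suc t) (length x) ⟩
  length x + suc t            ≤⟨ lx ⟩
  h                           ∎
  where open ≤-Reasoning

independent⇒subtreeIndependent : ∀ {h f} → IsIndependent h f → ∀ t x g → (∀ w → g w ≡ f (w ++ x)) →
  length x + t ≤ h → SubtreeIndependent t g
independent⇒subtreeIndependent ind zero    x g g≗f lx = tt
independent⇒subtreeIndependent {h} {f} ind (suc t) x g g≗f lx =
  cross , root , below false , below true
  where
  below : ∀ b → SubtreeIndependent t (g ↓ b)
  below b = independent⇒subtreeIndependent ind t (b ∷ x) (g ↓ b)
    (λ w → trans (g≗f (w ∷ʳ b)) (cong f (++-assoc w (b ∷ []) x)))
    (≤-trans (≤-reflexive (sym (+-suc (length x) t))) lx)
  cross : CrossIndependent t g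
  cross b w w' l l' p p' =
    subst₂ _<_ (sym (g≗f (w ∷ʳ b))) (cong (λ d → suc (suc d)) (+-comm (length w') (length w)))
    (independent⇒value<dist ind iv' iv (subst (0 <_) (g≗f _) p') (subst (0 <_) (g≗f _) p)
      (dist-across w' w x (not b) b (not-¬ refl ∘ sym) iv' iv) (s≤s z≤n))
    where
    iv : IsVertex h ((w ∷ʳ b) ++ x)
    iv = isVertex-∷ʳ-++ w b x l lx
    iv' : IsVertex h ((w' ∷ʳ not b) ++ x)
    iv' = isVertex-∷ʳ-++ w' (not b) x l' lx
  root : RootIndependent t g
  root b w l p p' =
    subst₂ _<_ (sym (g≗f [])) |w∷ʳb| (independent⇒value<dist ind iv ivx q' q (dist-up (w ∷ʳ b) x iv) d>0) ,
    subst₂ _<_ (sym (g≗f (w ∷ʳ b))) |w∷ʳb| (independent⇒value<dist ind ivx iv q q' (dist-down (w ∷ʳ b) x iv) d>0)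
    where
    iv : IsVertex h ((w ∷ʳ b) ++ x)
    iv = isVertex-∷ʳ-++ w b x l lx
    ivx : IsVertex h x
    ivx = ≤-trans (m≤m+n (length x) (suc t)) lx
    q : 0 < f x
    q = subst (0 <_) (g≗f []) p
    q' : 0 < f ((w ∷ʳ b) ++ x)
    q' = subst (0 <_) (g≗f (w ∷ʳ b)) p'
    |w∷ʳb| : length (w ∷ʳ b) ≡ suc (length w)
    |w∷ʳb| = length-∷ʳ w b
    d>0 : 0 < length (w ∷ʳ b)
    d>0 = subst (0 <_) (sym |w∷ʳb|) (s≤s z≤n)

broadcast⇒value≤ecc : ∀ {h f} → IsBroadcast h f → ∀ v → IsVertex h v → f v ≤ h + length v
broadcast⇒value≤ecc {h} {f} br v lv with br v lv
... | u , lu , d , (_ , minimal) , f≤d = begin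
  f v                     ≤⟨ f≤d ⟩
  d                       ≤⟨ minimal _ (walk-++ (proj₁ (dist-toRoot u lu)) (proj₁ (dist-fromRoot v lv))) ⟩
  length u + length v     ≤⟨ +-monoˡ-≤ (length v) lu ⟩
  _ + length v            ∎
  where open ≤-Reasoning

broadcast⇒reach≤2h : ∀ {h f} → IsBroadcast h f → reach h f ≤ h + h
broadcast⇒reach≤2h {h} {f} br = reach-≤ h f (h + h) λ w lw _ → begin
  f w + h                 ≤⟨ +-monoˡ-≤ h (broadcast⇒value≤ecc br w lw) ⟩
  h + length w + h        ≡⟨ shuffle h (length w) ⟩
  h + h + length w        ∎
  where
  open ≤-Reasoning
  shuffle : ∀ h l → h + l + h ≡ h + h + l
  shuffle = solve-∀

-- The profile values

n<2^n : ∀ n → n < 2 ^ n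
n<2^n zero    = s≤s z≤n
n<2^n (suc n) = +-mono-≤ (m^n>0 2 n) (≤-trans (n<2^n n) (≤-reflexive (sym (+-identityʳ _))))

-- C j = 24 (16 ^ j − 1) / 15: C j + 3 is α_b(T_{4j}) and 2 C j + 3 = 3 (16 ^ (j + 1) − 1) / 15.
C : ℕ → ℕ
C zero    = 0
C (suc j) = 16 * C j + 24

doubling : ∀ p c → 2 * p * c ≡ p * c + p * c
doubling = solve-∀

halfValue : ℕ → ℕ → ℕ
halfValue j k = 2 ^ suc k * (C j + 1)

fullValue : ℕ → ℕ → ℕ
fullValue j k = 2 ^ k * (2 * C j + 3)

8j≤C : ∀ j → 8 * j ≤ C j
8j≤C zero    = z≤n
8j≤C (suc j) = begin
  8 * suc j          ≡⟨ *-suc 8 j ⟩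
  8 + 8 * j          ≤⟨ +-monoʳ-≤ 8 (≤-trans (8j≤C j) (m≤n*m (C j) 16)) ⟩
  8 + 16 * C j       ≤⟨ +-monoˡ-≤ (16 * C j) (m≤m+n 8 16) ⟩
  24 + 16 * C j      ≡⟨ +-comm 24 (16 * C j) ⟩
  C (suc j)          ∎
  where open ≤-Reasoning

4j≤C : ∀ j → 4 * j ≤ C j
4j≤C j = ≤-trans (*-monoˡ-≤ j (m≤m+n 4 4)) (8j≤C j)

halfValue≤fullValue : ∀ j k → halfValue j k ≤ fullValue j k
halfValue≤fullValue j k = ≤-trans (m≤m+n _ (2 ^ k)) (≤-reflexive (sym (split (2 ^ k) (C j))))
  where
  split : ∀ p c → p * (2 * c + 3) ≡ 2 * p * (c + 1) + p
  split = solve-∀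

fullValue-+4 : ∀ j k → fullValue j (k + 4) ≤ fullValue (suc j) k
fullValue-+4 j k = begin
  2 ^ (k + 4) * (2 * C j + 3)            ≡⟨ cong (_* (2 * C j + 3)) (^-distribˡ-+-* 2 k 4) ⟩
  2 ^ k * 16 * (2 * C j + 3)             ≤⟨ m≤m+n _ (2 ^ k * 3) ⟩
  2 ^ k * 16 * (2 * C j + 3) + 2 ^ k * 3 ≡⟨ unfold (2 ^ k) (C j) ⟩
  fullValue (suc j) k                    ∎
  where
  open ≤-Reasoning
  unfold : ∀ p c → p * 16 * (2 * c + 3) + p * 3 ≡ p * (2 * (16 * c + 24) + 3)
  unfold = solve-∀

fullValue-shift : ∀ d j k → fullValue j (4 * d + k) ≤ fullValue (d + j) k
fullValue-shift zero    j k = ≤-refl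
fullValue-shift (suc d) j k = begin
  fullValue j (4 * suc d + k)   ≡⟨ cong (fullValue j) (reassoc d k) ⟩
  fullValue j (4 * d + k + 4)   ≤⟨ fullValue-+4 j (4 * d + k) ⟩
  fullValue (suc j) (4 * d + k) ≤⟨ fullValue-shift d (suc j) k ⟩
  fullValue (d + suc j) k       ≡⟨ cong (λ i → fullValue i k) (+-suc d j) ⟩
  fullValue (suc d + j) k       ∎
  where
  open ≤-Reasoning
  reassoc : ∀ d k → 4 * suc d + k ≡ 4 * d + k + 4
  reassoc = solve-∀

4*suc≡4*+4 : ∀ j → 4 * suc j ≡ 4 * j + 4
4*suc≡4*+4 j = trans (*-suc 4 j) (+-comm 4 (4 * j))

blocks≤ : ∀ {j k j' k'} → 4 * j + suc k ≡ 4 * j' + suc k' → k' ≤ 3 → j ≤ j'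
blocks≤ {j} {k} {j'} {k'} e k'≤3 with j ≤? j'
... | yes j≤j' = j≤j'
... | no  j≰j' = ⊥-elim (<-irrefl (sym e) (begin-strict
  4 * j' + suc k'  ≤⟨ +-monoʳ-≤ (4 * j') (s≤s k'≤3) ⟩
  4 * j' + 4       ≡⟨ 4*suc≡4*+4 j' ⟨
  4 * suc j'       ≤⟨ *-monoʳ-≤ 4 (≰⇒> j≰j') ⟩
  4 * j            <⟨ m<m+n (4 * j) (s≤s z≤n) ⟩
  4 * j + suc k    ∎))
  where open ≤-Reasoning

4*+suc-injective : ∀ {j k j' k'} → 4 * j + suc k ≡ 4 * j' + suc k' → k ≤ 3 → k' ≤ 3 → j ≡ j' × k ≡ k'
4*+suc-injective {j} {k} {j'} {k'} e k≤3 k'≤3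
  with ≤-antisym (blocks≤ {j} {k} {j'} {k'} e k'≤3) (blocks≤ (sym e) k≤3)
... | refl = refl , suc-injective (+-cancelˡ-≡ (4 * j) _ _ e)

fullValue-mono : ∀ {j k j' k'} → 4 * j + suc k ≡ 4 * j' + suc k' → j ≤ j' → fullValue j k ≤ fullValue j' k'
fullValue-mono {j} {k} {j'} {k'} e j≤j' with m≤n⇒∃[o]m+o≡n j≤j'
... | d , refl = subst₂ _≤_ (cong (fullValue j) (sym k≡)) (cong (λ i → fullValue i k') (+-comm d j))
  (fullValue-shift d j k')
  where
  k≡ : k ≡ 4 * d + k'
  k≡ = suc-injective (+-cancelˡ-≡ (4 * j) _ _ (trans e (reassoc j d k')))
    where
    reassoc : ∀ j d k' → 4 * (j + d) + suc k' ≡ 4 * j + suc (4 * d + k')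
    reassoc = solve-∀

2t+1≤fullValue : ∀ j k → suc ((4 * j + suc k) + (4 * j + suc k)) ≤ fullValue j k
2t+1≤fullValue j k = begin
  suc ((4 * j + suc k) + (4 * j + suc k)) ≡⟨ regroup j k ⟩
  (8 * j + 3) + k * 2                     ≤⟨ +-mono-≤ (+-monoˡ-≤ 3 (≤-trans (8j≤C j) (m≤n*m (C j) 2)))
                                                       (*-monoʳ-≤ k 2≤) ⟩
  (2 * C j + 3) + k * (2 * C j + 3)       ≤⟨ *-monoˡ-≤ (2 * C j + 3) (n<2^n k) ⟩
  fullValue j k                           ∎
  where
  open ≤-Reasoning
  regroup : ∀ j k → suc ((4 * j + suc k) + (4 * j + suc k)) ≡ (8 * j + 3) + k * 2
  regroup = solve-∀
  2≤ : 2 ≤ 2 * C j + 3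
  2≤ = ≤-trans (m≤m+n 2 1) (m≤n+m 3 (2 * C j))

4j+2≤halfValue : ∀ j k → 4 * j + 2 ≤ halfValue j k
4j+2≤halfValue j k = begin
  4 * j + 2          ≤⟨ +-monoˡ-≤ 2 (≤-trans (4j≤C j) (m≤n*m (C j) 2)) ⟩
  2 * C j + 2        ≡⟨ *-distribˡ-+ 2 (C j) 1 ⟨
  2 * (C j + 1)      ≤⟨ *-monoˡ-≤ (C j + 1) (*-monoʳ-≤ 2 (m^n>0 2 k)) ⟩
  halfValue j k      ∎
  where open ≤-Reasoning

height≤halfValue : ∀ j k → 4 * j + suc k ≤ halfValue j k
height≤halfValue j k = begin
  4 * j + suc k                 ≤⟨ +-mono-≤ (4j≤C j) (≤-trans (n≤1+n (suc k)) (n<2^n (suc k))) ⟩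
  C j + 2 ^ suc k               ≡⟨ cong (_+ 2 ^ suc k) (*-identityˡ (C j)) ⟨
  1 * C j + 2 ^ suc k           ≤⟨ +-monoˡ-≤ (2 ^ suc k) (*-monoˡ-≤ (C j) (m^n>0 2 (suc k))) ⟩
  2 ^ suc k * C j + 2 ^ suc k   ≡⟨ distrib (2 ^ suc k) (C j) ⟩
  halfValue j k                 ∎
  where
  open ≤-Reasoning
  distrib : ∀ p c → p * c + p ≡ p * (c + 1)
  distrib = solve-∀

4t+2≤fullValue₀ : ∀ t → suc (t + t) + suc (t + t) ≤ fullValue 0 t
4t+2≤fullValue₀ 0 = m≤m+n 2 1
4t+2≤fullValue₀ 1 = ≤-refl
4t+2≤fullValue₀ (suc (suc t)) = begin
  suc (suc (suc t) + suc (suc t)) + suc (suc (suc t) + suc (suc t)) ≡⟨ regroup t ⟩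
  X + 4                                      ≤⟨ +-monoʳ-≤ X (≤-trans (m≤m+n 4 _) (≤-reflexive (regroup' t))) ⟩
  X + X                                      ≤⟨ +-mono-≤ (4t+2≤fullValue₀ (suc t)) (4t+2≤fullValue₀ (suc t)) ⟩
  fullValue 0 (suc t) + fullValue 0 (suc t)  ≡⟨ doubling (2 ^ suc t) 3 ⟨
  fullValue 0 (suc (suc t))                  ∎
  where
  open ≤-Reasoning
  X : ℕ
  X = suc (suc t + suc t) + suc (suc t + suc t)
  regroup : ∀ t → suc (suc (suc t) + suc (suc t)) + suc (suc (suc t) + suc (suc t))
                ≡ (suc (suc t + suc t) + suc (suc t + suc t)) + 4
  regroup = solve-∀
  regroup' : ∀ t → 4 + (2 + 4 * t) ≡ suc (suc t + suc t) + suc (suc t + suc t)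
  regroup' = solve-∀

small+small≤halfValue₀ : ∀ t {a b} → a ≤ 2 → b ≤ 2 → a ≤ suc (t + t) → b ≤ suc (t + t) →
  a + b ≤ halfValue 0 t
small+small≤halfValue₀ zero    _   _   a≤1 b≤1 = +-mono-≤ a≤1 b≤1
small+small≤halfValue₀ (suc t) a≤2 b≤2 _   _   =
  ≤-trans (+-mono-≤ a≤2 b≤2) (*-monoˡ-≤ 1 (*-monoʳ-≤ 2 (*-monoʳ-≤ 2 (m^n>0 2 t))))

3t≤halfValue₀ : ∀ t → t + t + t ≤ halfValue 0 t
3t≤halfValue₀ zero          = z≤n
3t≤halfValue₀ (suc zero)    = m≤m+n 3 1
3t≤halfValue₀ (suc (suc t)) = begin
  suc (suc t) + suc (suc t) + suc (suc t)         ≡⟨ regroup t ⟩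
  (suc t + suc t + suc t) + 3                     ≤⟨ +-mono-≤ (3t≤halfValue₀ (suc t)) 3≤ ⟩
  halfValue 0 (suc t) + halfValue 0 (suc t)       ≡⟨ doubling (2 ^ suc (suc t)) 1 ⟨
  halfValue 0 (suc (suc t))                       ∎
  where
  open ≤-Reasoning
  regroup : ∀ t → suc (suc t) + suc (suc t) + suc (suc t) ≡ (suc t + suc t + suc t) + 3
  regroup = solve-∀
  3≤ : 3 ≤ halfValue 0 (suc t)
  3≤ = ≤-trans (m≤m+n 3 1) (*-monoˡ-≤ 1 (*-monoʳ-≤ 2 (*-monoʳ-≤ 2 (m^n>0 2 t))))

2+k+t≤fullValue : ∀ j k → suc (suc k + (4 * j + suc k)) ≤ fullValue j k
2+k+t≤fullValue j k = ≤-trans (s≤s (+-monoˡ-≤ (4 * j + suc k) (m≤n+m (suc k) (4 * j)))) (2t+1≤fullValue j k)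

fullValue-suc : ∀ j k → fullValue j (suc k) ≡ fullValue j k + halfValue j k + 2 ^ k
fullValue-suc j k = split (2 ^ k) (C j)
  where
  split : ∀ p c → 2 * p * (2 * c + 3) ≡ p * (2 * c + 3) + 2 * p * (c + 1) + p
  split = solve-∀

4j+4j≤C : ∀ j → 4 * j + 4 * j ≤ C j
4j+4j≤C j = ≤-trans (≤-reflexive (sym (*-distribʳ-+ j 4 4))) (8j≤C j)

4j+1≤C : ∀ j → 1 ≤ j → suc (4 * j) ≤ C j
4j+1≤C j 1≤j = ≤-trans (+-monoˡ-≤ (4 * j) (≤-trans 1≤j (m≤n*m j 4))) (4j+4j≤C j)

4j+2≤2C+2 : ∀ j → suc (4 * j + 1) ≤ 2 * C j + 2
4j+2≤2C+2 j = ≤-trans (≤-reflexive (sym (+-suc (4 * j) 1))) (+-monoˡ-≤ 2 (≤-trans (4j≤C j) (m≤n*m (C j) 2)))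

-- Profiles and the induction invariant

-- half and full are the regular profiles (maxDepth ≥ 1); root₀ and root₁ need the root to broadcast.
data Profile (t : ℕ) : Set where
  half  : ∀ j k → t ≡ 4 * j + suc k → Profile t
  full  : ∀ j k → t ≡ 4 * j + suc k → Profile t
  root₀ : ∀ J f → t ≡ 4 * J → 1 ≤ J → 1 ≤ f → f ≤ 3 → Profile t
  root₁ : ∀ J → t ≡ 4 * J + 1 → Profile t

minReach : ∀ {t} → Profile t → ℕ
minReach (half j k _)        = 4 * j + 1
minReach (full j k _)        = 4 * j + 3
minReach (root₀ J f _ _ _ _) = 4 * J + f
minReach (root₁ J _)         = 4 * J + 5

maxDepth : ∀ {t} → Profile t → ℕ
maxDepth (half j k _)        = suc k
maxDepth (full j k _)        = suc k
maxDepth (root₀ J f _ _ _ _) = 0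
maxDepth (root₁ J _)         = 0

value : ∀ {t} → Profile t → ℕ
value (half j k _)        = halfValue j k
value (full j k _)        = fullValue j k
value (root₀ J f _ _ _ _) = C J + f
value (root₁ J _)         = 2 * C J + 4

Fits : ∀ {t} → Profile t → ℕ → ℕ → ℕ → Set
Fits P s b w = minReach P ≤ s × b ≤ maxDepth P × w ≤ value P

-- The induction invariant for a subtree of height t whose broadcast has reach s, least broadcasting
-- depth b and weight w: either w is at most (s − t) + b, the weight of a lone broadcasting vertex,
-- or w is bounded by the value of a profile whose reach and depth requirements s and b meet.
data Bounded (t s b w : ℕ) : Set where
  single : w + t ≤ s + b → Bounded t s b w
  within : (P : Profile t) → Fits P s b w → Bounded t s b w

record Summary (t s b w : ℕ) : Set where
  field
    bounded     : Bounded t s b w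
    silent⇒w≡0  : s ≡ 0 → w ≡ 0
    silent⇒b≡   : s ≡ 0 → b ≡ suc t
    b≤suc       : b ≤ suc t
    active⇒b≤t  : 1 ≤ s → b ≤ t

bounded-cong : ∀ {t s s' b b' w w'} → s ≡ s' → b ≡ b' → w ≡ w' → Bounded t s b w → Bounded t s' b' w'
bounded-cong refl refl refl x = x

bounded-swap : ∀ {t} s₀ b₀ w₀ s₁ b₁ w₁ → Bounded t (s₁ ⊔ s₀) (suc (b₁ ⊓ b₀)) (w₁ + w₀) →
  Bounded t (s₀ ⊔ s₁) (suc (b₀ ⊓ b₁)) (w₀ + w₁)
bounded-swap s₀ b₀ w₀ s₁ b₁ w₁ = bounded-cong (⊔-comm s₁ s₀) (cong suc (⊓-comm b₁ b₀)) (+-comm w₁ w₀)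

suc-height : ∀ {t} j k → t ≡ 4 * j + suc k → suc t ≡ 4 * j + suc (suc k)
suc-height j k e = trans (cong suc e) (sym (+-suc (4 * j) (suc k)))

suc-height₀ : ∀ {t} J → t ≡ 4 * J → suc t ≡ 4 * J + suc 0
suc-height₀ J e = trans (cong suc e) (+-comm 1 (4 * J))

suc-height₁ : ∀ {t} J → t ≡ 4 * J + 1 → suc t ≡ 4 * J + suc 1
suc-height₁ J e = trans (cong suc e) (sym (+-suc (4 * J) 1))

bounded-double : ∀ {t} (P : Profile t) → 1 ≤ maxDepth P → ∀ {s b w} →
  minReach P ≤ s → b ≤ maxDepth P → w ≤ value P + value P → Bounded (suc t) s (suc b) w
bounded-double (half j k e) _ r d v = within (half j (suc k) (suc-height j k e))
  (r , s≤s d , ≤-trans v (≤-reflexive (sym (doubling (2 ^ suc k) (C j + 1)))))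
bounded-double (full j k e) _ r d v = within (full j (suc k) (suc-height j k e))
  (r , s≤s d , ≤-trans v (≤-reflexive (sym (doubling (2 ^ k) (2 * C j + 3)))))

join-root₀ : ∀ {t s m wA wB} J f → t ≡ 4 * J → 1 ≤ f → f ≤ 3 → 4 * J + f ≤ s → m ≤ 0 →
  wA ≤ C J → wB ≤ C J + f → Bounded (suc t) s (suc m) (wA + wB)
join-root₀ {s = s} {m} {wA} {wB} J f refl 1≤f f≤3 r d wA≤ wB≤ = choose (f ≤? 2)
  where
  choose : Dec (f ≤ 2) → Bounded (suc (4 * J)) s (suc m) (wA + wB)
  choose (yes f≤2) = within (half J 0 (suc-height₀ J refl)) (≤-trans (+-monoʳ-≤ (4 * J) 1≤f) r , s≤s d ,
    ≤-trans (+-mono-≤ wA≤ (≤-trans wB≤ (+-monoʳ-≤ (C J) f≤2))) (≤-reflexive (sym (unfold (C J)))))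
    where
    unfold : ∀ c → 2 ^ 1 * (c + 1) ≡ c + (c + 2)
    unfold = solve-∀
  choose (no f≰2) = within (full J 0 (suc-height₀ J refl)) (≤-trans (+-monoʳ-≤ (4 * J) (≰⇒> f≰2)) r , s≤s d ,
    ≤-trans (+-mono-≤ wA≤ (≤-trans wB≤ (+-monoʳ-≤ (C J) f≤3))) (≤-reflexive (sym (unfold (C J)))))
    where
    unfold : ∀ c → 2 ^ 0 * (2 * c + 3) ≡ c + (c + 3)
    unfold = solve-∀

join-root₁ : ∀ {t s m wA wB} J → t ≡ 4 * J + 1 → 4 * J + 5 ≤ s → m ≤ 0 →
  wA ≤ 2 * C J + 2 → wB ≤ 2 * C J + 4 → Bounded (suc t) s (suc m) (wA + wB)
join-root₁ J refl r d wA≤ wB≤ =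
  within (full J 1 (suc-height₁ J refl)) (≤-trans (+-monoʳ-≤ (4 * J) (m≤n+m 3 2)) r , s≤s (≤-trans d z≤n) ,
        ≤-trans (+-mono-≤ wA≤ wB≤) (≤-reflexive (sym (unfold (C J)))))
  where
  unfold : ∀ c → 2 ^ 1 * (2 * c + 3) ≡ (2 * c + 2) + (2 * c + 4)
  unfold = solve-∀

-- A silent root put above a single non-silent subtree.
bounded-lift : ∀ {t s b w} → Bounded t s b w → Bounded (suc t) s (suc b) w
bounded-lift {t} {s} {b} {w} (single x) = single (subst₂ _≤_ (sym (+-suc w t)) (sym (+-suc s b)) (s≤s x))
bounded-lift (within P@(half _ _ _) (r , d , v)) = bounded-double P (s≤s z≤n) r d (≤-trans v (m≤m+n _ _))
bounded-lift (within P@(full _ _ _) (r , d , v)) = bounded-double P (s≤s z≤n) r d (≤-trans v (m≤m+n _ _))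
bounded-lift (within (root₀ J f e _ 1≤f f≤3) (r , d , v)) = join-root₀ J f e 1≤f f≤3 r d z≤n v
bounded-lift (within (root₁ J e) (r , d , v)) = join-root₁ J e r d z≤n v

-- Joining two subtrees below a silent root

single⇒weight≤reach : ∀ {t s b w} → w + t ≤ s + b → b ≤ t → w ≤ s
single⇒weight≤reach {t} {s} {b} {w} x b≤t = +-cancelʳ-≤ t w s (≤-trans x (+-monoʳ-≤ s b≤t))

join-singles : ∀ {t s₀ b₀ w₀ s₁ b₁ w₁} → w₀ + t ≤ s₀ + b₀ → w₁ + t ≤ s₁ + b₁ → 1 ≤ s₀ → b₀ ≤ t → b₁ ≤ t →
  s₀ ≤ suc (t + b₁) → s₁ ≤ suc (t + b₀) → Bounded (suc t) (s₀ ⊔ s₁) (suc (b₀ ⊓ b₁)) (w₀ + w₁)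
join-singles {t} {s₀} {b₀} {w₀} {s₁} {b₁} {w₁} x₀ x₁ 1≤s₀ b₀≤t b₁≤t X₀ X₁ = choose (3 ≤? s₀ ⊔ s₁)
  where
  depth : b₀ ⊓ b₁ ≤ t
  depth = ≤-trans (m⊓n≤m b₀ b₁) b₀≤t
  weight≤2t+1 : ∀ {s b b' w} → w + t ≤ s + b → s ≤ suc (t + b') → b ≤ t → b' ≤ t → w ≤ suc (t + t)
  weight≤2t+1 {s} {b} {b'} {w} x X b≤t b'≤t =
    +-cancelʳ-≤ t w (suc (t + t)) (≤-trans x (+-mono-≤ (≤-trans X (s≤s (+-monoʳ-≤ t b'≤t))) b≤t))
  w₀≤ : w₀ ≤ suc (t + t)
  w₀≤ = weight≤2t+1 x₀ X₀ b₀≤t b₁≤t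
  w₁≤ : w₁ ≤ suc (t + t)
  w₁≤ = weight≤2t+1 x₁ X₁ b₁≤t b₀≤t
  choose : Dec (3 ≤ s₀ ⊔ s₁) → Bounded (suc t) (s₀ ⊔ s₁) (suc (b₀ ⊓ b₁)) (w₀ + w₁)
  choose (yes 3≤s) = within (full 0 t refl) (3≤s , s≤s depth , ≤-trans (+-mono-≤ w₀≤ w₁≤) (4t+2≤fullValue₀ t))
  choose (no  3≰s) = within (half 0 t refl) (≤-trans 1≤s₀ (m≤m⊔n s₀ s₁) , s≤s depth ,
    small+small≤halfValue₀ t (≤-trans (single⇒weight≤reach x₀ b₀≤t) (≤-trans (m≤m⊔n s₀ s₁) s≤2))
                             (≤-trans (single⇒weight≤reach x₁ b₁≤t) (≤-trans (m≤n⊔m s₀ s₁) s≤2)) w₀≤ w₁≤)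
    where
    s≤2 : s₀ ⊔ s₁ ≤ 2
    s≤2 = ≤-pred (≰⇒> 3≰s)

join-single-half : ∀ {t s m wA wB} j k → t ≡ 4 * j + suc k → 4 * j + 1 ≤ s → m ≤ suc k →
  wA ≤ s → wA ≤ suc (suc k + t) → wB ≤ halfValue j k → Bounded (suc t) s (suc m) (wA + wB)
join-single-half {s = s} {m} {wA} {wB} j k refl r d wA≤s wA≤ wB≤ = choose (4 * j + 3 ≤? s)
  where
  choose : Dec (4 * j + 3 ≤ s) → Bounded (suc (4 * j + suc k)) s (suc m) (wA + wB)
  choose (yes r') = within (full j (suc k) (suc-height j k refl)) (r' , s≤s d , (begin
    wA + wB                                ≤⟨ +-mono-≤ (≤-trans wA≤ (2+k+t≤fullValue j k)) wB≤ ⟩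
    fullValue j k + halfValue j k          ≤⟨ m≤m+n _ (2 ^ k) ⟩
    fullValue j k + halfValue j k + 2 ^ k  ≡⟨ fullValue-suc j k ⟨
    fullValue j (suc k)                    ∎))
    where open ≤-Reasoning
  choose (no r') = within (half j (suc k) (suc-height j k refl)) (r , s≤s d , (begin
    wA + wB                                ≤⟨ +-mono-≤ (≤-trans wA≤4j+2 (4j+2≤halfValue j k)) wB≤ ⟩
    halfValue j k + halfValue j k          ≡⟨ doubling (2 ^ suc k) (C j + 1) ⟨
    halfValue j (suc k)                    ∎))
    where
    open ≤-Reasoning
    wA≤4j+2 : wA ≤ 4 * j + 2
    wA≤4j+2 = ≤-pred (≤-trans (s≤s wA≤s) (≤-trans (≰⇒> r') (≤-reflexive (+-suc (4 * j) 2))))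

join-single-full : ∀ {t s m wA wB} j k → t ≡ 4 * j + suc k → 4 * j + 3 ≤ s → m ≤ suc k →
  wA ≤ suc (suc k + t) → wB ≤ fullValue j k → Bounded (suc t) s (suc m) (wA + wB)
join-single-full j k refl r d wA≤ wB≤ =
  bounded-double (full j k refl) (s≤s z≤n) r d (+-mono-≤ (≤-trans wA≤ (2+k+t≤fullValue j k)) wB≤)

join-single-profile : ∀ {t sA bA wA sB bB wB} → wA + t ≤ sA + bA → (P : Profile t) → Fits P sB bB wB →
  bA ≤ t → sA ≤ suc (t + bB) → sB ≤ suc (t + bA) → Bounded (suc t) (sA ⊔ sB) (suc (bA ⊓ bB)) (wA + wB)
join-single-profile {t} {sA} {bA} {wA} {sB} {bB} {wB} xA P (r , d , v) bA≤t XA XB = case P r d v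
  where
  wA≤s : wA ≤ sA ⊔ sB
  wA≤s = ≤-trans (single⇒weight≤reach xA bA≤t) (m≤m⊔n sA sB)
  wA≤ : wA ≤ suc (bB + bA)
  wA≤ = +-cancelʳ-≤ t wA (suc (bB + bA)) (≤-trans xA (≤-trans (+-monoˡ-≤ bA XA) (≤-reflexive (regroup t bB bA))))
    where
    regroup : ∀ t b b' → suc (t + b) + b' ≡ suc (b + b') + t
    regroup = solve-∀
  wA≤suc[d+t] : ∀ {d} → bB ≤ d → wA ≤ suc (d + t)
  wA≤suc[d+t] bB≤d = ≤-trans wA≤ (s≤s (+-mono-≤ bB≤d bA≤t))
  depth : ∀ {d} → bB ≤ d → bA ⊓ bB ≤ d
  depth bB≤d = ≤-trans (m⊓n≤n bA bB) bB≤d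
  reach≤ : ∀ {ρ} → ρ ≤ sB → ρ ≤ sA ⊔ sB
  reach≤ ρ≤ = ≤-trans ρ≤ (m≤n⊔m sA sB)
  case : (P : Profile t) → minReach P ≤ sB → bB ≤ maxDepth P → wB ≤ value P →
    Bounded (suc t) (sA ⊔ sB) (suc (bA ⊓ bB)) (wA + wB)
  case (half j k e) r d v = join-single-half j k e (reach≤ r) (depth d) wA≤s (wA≤suc[d+t] d) v
  case (full j k e) r d v = join-single-full j k e (reach≤ r) (depth d) (wA≤suc[d+t] d) v
  case (root₀ J f e 1≤J 1≤f f≤3) r d v = join-root₀ J f e 1≤f f≤3 (reach≤ r) (depth d) wA≤C v
    where
    wA≤C : wA ≤ C J
    wA≤C = ≤-trans (wA≤suc[d+t] d) (≤-trans (s≤s (≤-reflexive e)) (4j+1≤C J 1≤J))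
  case (root₁ J e) r d v = join-root₁ J e (reach≤ r) (depth d) wA≤2C+2 v
    where
    wA≤2C+2 : wA ≤ 2 * C J + 2
    wA≤2C+2 = ≤-trans (wA≤suc[d+t] d) (≤-trans (s≤s (≤-reflexive e)) (4j+2≤2C+2 J))

regular-value≤C : ∀ {t} J (P : Profile t) → 1 ≤ maxDepth P → t ≡ 4 * J → value P ≤ C J
regular-value≤C zero    (half j k e) _ e' with () ← m+n≡0⇒n≡0 (4 * j) (trans (sym e) e')
regular-value≤C zero    (full j k e) _ e' with () ← m+n≡0⇒n≡0 (4 * j) (trans (sym e) e')
regular-value≤C (suc J) (half j k e) _ e' =
  ≤-trans (halfValue≤fullValue j k) (regular-value≤C (suc J) (full j k e) (s≤s z≤n) e')
regular-value≤C (suc J) (full j k e) _ e' =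
  ≤-trans (fullValue-mono {j} {k} {J} {3} t≡ (blocks≤ t≡ ≤-refl)) (≤-reflexive (unfold (C J)))
  where
  t≡ : 4 * j + suc k ≡ 4 * J + suc 3
  t≡ = trans (sym e) (trans e' (4*suc≡4*+4 J))
  unfold : ∀ c → 2 ^ 3 * (2 * c + 3) ≡ 16 * c + 24
  unfold = solve-∀

fullValue≤2C : ∀ {j k J} → 4 * j + suc k ≡ 4 * J + 1 → j < J → fullValue j k ≤ 2 * C J
fullValue≤2C {j} {k} {suc J} t≡ (s≤s j≤J) =
  ≤-trans (fullValue-mono {j} {k} {J} {4} (trans t≡ (reassoc J)) j≤J) (≤-reflexive (unfold (C J)))
  where
  reassoc : ∀ J → 4 * suc J + 1 ≡ 4 * J + suc 4
  reassoc = solve-∀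
  unfold : ∀ c → 2 ^ 4 * (2 * c + 3) ≡ 2 * (16 * c + 24)
  unfold = solve-∀

regular-value≤2C+2 : ∀ {t} J (P : Profile t) → 1 ≤ maxDepth P → t ≡ 4 * J + 1 →
  minReach P ≤ suc (suc (4 * J)) → value P ≤ 2 * C J + 2
regular-value≤2C+2 J (half j k e) _ e' r with m≤n⇒m<n∨m≡n (blocks≤ {j} {k} {J} {0} (trans (sym e) e') z≤n)
... | inj₁ j<J = ≤-trans (halfValue≤fullValue j k) (≤-trans (fullValue≤2C (trans (sym e) e') j<J) (m≤m+n _ 2))
... | inj₂ refl with refl ← suc-injective (+-cancelˡ-≡ (4 * j) _ _ (trans (sym e) e')) = ≤-reflexive (unfold (C j))
  where
  unfold : ∀ c → 2 ^ 1 * (c + 1) ≡ 2 * c + 2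
  unfold = solve-∀
regular-value≤2C+2 J (full j k e) _ e' r with m≤n⇒m<n∨m≡n (blocks≤ {j} {k} {J} {0} (trans (sym e) e') z≤n)
... | inj₁ j<J = ≤-trans (fullValue≤2C (trans (sym e) e') j<J) (m≤m+n _ 2)
... | inj₂ refl =
  ⊥-elim (<-irrefl refl (≤-trans (≤-reflexive (sym (+-suc (4 * j) 2))) (≤-trans r (≤-reflexive (+-comm 2 (4 * j))))))

join-regulars : ∀ {t s₀ b₀ w₀ s₁ b₁ w₁} (P₀ P₁ : Profile t) → 1 ≤ maxDepth P₀ → 1 ≤ maxDepth P₁ →
  Fits P₀ s₀ b₀ w₀ → Fits P₁ s₁ b₁ w₁ → Bounded (suc t) (s₀ ⊔ s₁) (suc (b₀ ⊓ b₁)) (w₀ + w₁)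
join-regulars {s₀ = s₀} {b₀} {s₁ = s₁} {b₁} P₀ P₁ reg₀ reg₁ (r₀ , d₀ , v₀) (r₁ , d₁ , v₁)
  with ≤-total (value P₀) (value P₁)
... | inj₁ v₀≤v₁ = bounded-double P₁ reg₁ (≤-trans r₁ (m≤n⊔m s₀ s₁)) (≤-trans (m⊓n≤n b₀ b₁) d₁)
                     (+-mono-≤ (≤-trans v₀ v₀≤v₁) v₁)
... | inj₂ v₁≤v₀ = bounded-double P₀ reg₀ (≤-trans r₀ (m≤m⊔n s₀ s₁)) (≤-trans (m⊓n≤m b₀ b₁) d₀)
                     (+-mono-≤ v₀ (≤-trans v₁ v₁≤v₀))

join-regular-profile : ∀ {t s₀ b₀ w₀ s₁ b₁ w₁} (P₀ : Profile t) → 1 ≤ maxDepth P₀ → Fits P₀ s₀ b₀ w₀ →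
  (P₁ : Profile t) → Fits P₁ s₁ b₁ w₁ → s₀ ≤ suc (t + b₁) → Bounded (suc t) (s₀ ⊔ s₁) (suc (b₀ ⊓ b₁)) (w₀ + w₁)
join-regular-profile P₀ reg₀ fit₀ P₁@(half _ _ _) fit₁ _ = join-regulars P₀ P₁ reg₀ (s≤s z≤n) fit₀ fit₁
join-regular-profile P₀ reg₀ fit₀ P₁@(full _ _ _) fit₁ _ = join-regulars P₀ P₁ reg₀ (s≤s z≤n) fit₀ fit₁
join-regular-profile {s₀ = s₀} {b₀} {s₁ = s₁} {b₁} P₀ reg₀ (_ , _ , v₀) (root₀ J f e _ 1≤f f≤3) (r₁ , d₁ , v₁) _ =
  join-root₀ J f e 1≤f f≤3 (≤-trans r₁ (m≤n⊔m s₀ s₁)) (≤-trans (m⊓n≤n b₀ b₁) d₁)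
    (≤-trans v₀ (regular-value≤C J P₀ reg₀ e)) v₁
join-regular-profile {t} {s₀} {b₀} {s₁ = s₁} {b₁} P₀ reg₀ (r₀ , _ , v₀) (root₁ J e) (r₁ , d₁ , v₁) X₀ =
  join-root₁ J e (≤-trans r₁ (m≤n⊔m s₀ s₁)) (≤-trans (m⊓n≤n b₀ b₁) d₁)
    (≤-trans v₀ (regular-value≤2C+2 J P₀ reg₀ e reach₀)) v₁
  where
  reach₀ : minReach P₀ ≤ suc (suc (4 * J))
  reach₀ = ≤-trans r₀ (≤-trans X₀ (≤-reflexive (cong suc (trans (cong₂ _+_ e (n≤0⇒n≡0 d₁)) (regroup J)))))
    where
    regroup : ∀ J → 4 * J + 1 + 0 ≡ suc (4 * J)
    regroup = solve-∀

root₁-beside-root : ∀ {t s b} J → t ≡ 4 * J + 1 → 4 * J + 5 ≤ s → s ≤ suc (t + b) → b ≤ 0 → ⊥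
root₁-beside-root {b = zero} J refl r X _
  with s≤s (s≤s ()) ← +-cancelˡ-≤ (4 * J) 5 2
         (≤-trans r (≤-trans X (≤-reflexive (trans (cong suc (+-identityʳ (4 * J + 1))) (sym (+-suc (4 * J) 1))))))

join-root₀-root₀ : ∀ {t s₀ b₀ w₀ s₁ b₁ w₁} J f J' f' → t ≡ 4 * J → t ≡ 4 * J' → 1 ≤ f →
  4 * J + f ≤ s₀ → b₀ ≤ 0 → w₀ ≤ C J + f → 4 * J' + f' ≤ s₁ → b₁ ≤ 0 → w₁ ≤ C J' + f' →
  s₀ ≤ suc (t + b₁) → s₁ ≤ suc (t + b₀) → Bounded (suc t) (s₀ ⊔ s₁) (suc (b₀ ⊓ b₁)) (w₀ + w₁)
join-root₀-root₀ {s₀ = s₀} {b₀} {w₀} {s₁} {b₁} {w₁} J f J' f' refl e' 1≤f r₀ d₀ v₀ r₁ d₁ v₁ X₀ X₁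
  with refl ← *-cancelˡ-≡ J J' 4 e' =
  within (half J 0 (suc-height₀ J refl)) (≤-trans (+-monoʳ-≤ (4 * J) 1≤f) (≤-trans r₀ (m≤m⊔n s₀ s₁)) ,
        s≤s (≤-trans (m⊓n≤m b₀ b₁) d₀) ,
        ≤-trans (+-mono-≤ (weight≤ r₀ v₀ X₀ d₁) (weight≤ r₁ v₁ X₁ d₀)) (≤-reflexive (sym (unfold (C J)))))
  where
  unfold : ∀ c → 2 ^ 1 * (c + 1) ≡ (c + 1) + (c + 1)
  unfold = solve-∀
  weight≤ : ∀ {g s b w} → 4 * J + g ≤ s → w ≤ C J + g → s ≤ suc (4 * J + b) → b ≤ 0 → w ≤ C J + 1
  weight≤ {g} {b = zero} r v X _ =
    ≤-trans v (+-monoʳ-≤ (C J) (+-cancelˡ-≤ (4 * J) g 1 (≤-trans r (≤-trans X (≤-reflexive (regroup J))))))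
    where
    regroup : ∀ J → suc (4 * J + 0) ≡ 4 * J + 1
    regroup = solve-∀

join-profiles : ∀ {t s₀ b₀ w₀ s₁ b₁ w₁} (P₀ P₁ : Profile t) → Fits P₀ s₀ b₀ w₀ → Fits P₁ s₁ b₁ w₁ →
  s₀ ≤ suc (t + b₁) → s₁ ≤ suc (t + b₀) → Bounded (suc t) (s₀ ⊔ s₁) (suc (b₀ ⊓ b₁)) (w₀ + w₁)
join-profiles P₀@(half _ _ _) P₁ fit₀ fit₁ X₀ X₁ = join-regular-profile P₀ (s≤s z≤n) fit₀ P₁ fit₁ X₀
join-profiles P₀@(full _ _ _) P₁ fit₀ fit₁ X₀ X₁ = join-regular-profile P₀ (s≤s z≤n) fit₀ P₁ fit₁ X₀
join-profiles {s₀ = s₀} {b₀} {w₀} {s₁} {b₁} {w₁} P₀ P₁@(half _ _ _) fit₀ fit₁ X₀ X₁ =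
  bounded-swap s₀ b₀ w₀ s₁ b₁ w₁ (join-regular-profile P₁ (s≤s z≤n) fit₁ P₀ fit₀ X₁)
join-profiles {s₀ = s₀} {b₀} {w₀} {s₁} {b₁} {w₁} P₀ P₁@(full _ _ _) fit₀ fit₁ X₀ X₁ =
  bounded-swap s₀ b₀ w₀ s₁ b₁ w₁ (join-regular-profile P₁ (s≤s z≤n) fit₁ P₀ fit₀ X₁)
join-profiles (root₀ J f e _ 1≤f _) (root₀ J' f' e' _ _ _) (r₀ , d₀ , v₀) (r₁ , d₁ , v₁) X₀ X₁ =
  join-root₀-root₀ J f J' f' e e' 1≤f r₀ d₀ v₀ r₁ d₁ v₁ X₀ X₁
join-profiles (root₀ _ _ _ _ _ _) (root₁ J e) (_ , d₀ , _) (r₁ , _ , _) _ X₁ = ⊥-elim (root₁-beside-root J e r₁ X₁ d₀)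
join-profiles (root₁ J e) (root₀ _ _ _ _ _ _) (r₀ , _ , _) (_ , d₁ , _) X₀ _ = ⊥-elim (root₁-beside-root J e r₀ X₀ d₁)
join-profiles (root₁ J e) (root₁ _ _)         (r₀ , _ , _) (_ , d₁ , _) X₀ _ = ⊥-elim (root₁-beside-root J e r₀ X₀ d₁)

join : ∀ {t s₀ b₀ w₀ s₁ b₁ w₁} → Bounded t s₀ b₀ w₀ → Bounded t s₁ b₁ w₁ → 1 ≤ s₀ → b₀ ≤ t → b₁ ≤ t →
  s₀ ≤ suc (t + b₁) → s₁ ≤ suc (t + b₀) → Bounded (suc t) (s₀ ⊔ s₁) (suc (b₀ ⊓ b₁)) (w₀ + w₁)
join (single x₀)     (single x₁)     1≤s₀ b₀≤t b₁≤t X₀ X₁ = join-singles x₀ x₁ 1≤s₀ b₀≤t b₁≤t X₀ X₁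
join (single x₀)     (within P fit)   _    b₀≤t _    X₀ X₁ = join-single-profile x₀ P fit b₀≤t X₀ X₁
join {s₀ = s₀} {b₀} {w₀} {s₁} {b₁} {w₁} (within P fit) (single x₁) _ _ b₁≤t X₀ X₁ =
  bounded-swap s₀ b₀ w₀ s₁ b₁ w₁ (join-single-profile x₁ P fit b₁≤t X₁ X₀)
join (within P₀ fit₀) (within P₁ fit₁) _    _    _    X₀ X₁ = join-profiles P₀ P₁ fit₀ fit₁ X₀ X₁

bounded-silentRoot : ∀ {t s₀ b₀ w₀ s₁ b₁ w₁} → Summary t s₀ b₀ w₀ → Summary t s₁ b₁ w₁ →
  (1 ≤ s₀ → 1 ≤ s₁ → s₀ ≤ suc (t + b₁)) → (1 ≤ s₀ → 1 ≤ s₁ → s₁ ≤ suc (t + b₀)) →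
  Bounded (suc t) (s₀ ⊔ s₁) (suc (b₀ ⊓ b₁)) (w₀ + w₁)
bounded-silentRoot {s₀ = zero} {b₀} {w₀} {b₁ = b₁} {w₁} S₀ S₁ _ _ =
  bounded-cong refl (cong suc (sym (trans (cong (_⊓ b₁) (silent⇒b≡ S₀ refl)) (m≥n⇒m⊓n≡n (b≤suc S₁)))))
    (cong (_+ w₁) (sym (silent⇒w≡0 S₀ refl))) (bounded-lift (bounded S₁))
  where open Summary
bounded-silentRoot {s₀ = suc _} {b₀} {w₀} {s₁ = zero} S₀ S₁ _ _ =
  bounded-cong refl (cong suc (sym (trans (cong (b₀ ⊓_) (silent⇒b≡ S₁ refl)) (m≤n⇒m⊓n≡m (b≤suc S₀)))))
    (trans (sym (+-identityʳ w₀)) (cong (w₀ +_) (sym (silent⇒w≡0 S₁ refl)))) (bounded-lift (bounded S₀))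
  where open Summary
bounded-silentRoot {s₀ = suc _} {s₁ = suc _} S₀ S₁ X₀ X₁ =
  join (bounded S₀) (bounded S₁) (s≤s z≤n) (active⇒b≤t S₀ (s≤s z≤n)) (active⇒b≤t S₁ (s≤s z≤n))
    (X₀ (s≤s z≤n) (s≤s z≤n)) (X₁ (s≤s z≤n) (s≤s z≤n))
  where open Summary

-- Joining two subtrees below a broadcasting root

root-over-half : ∀ {r s W} j k → 1 ≤ r → r ≤ suc k → r + suc (4 * j + suc k) ≤ s →
  W ≤ r + (halfValue j k + halfValue j k) → Bounded (suc (4 * j + suc k)) s 0 W
root-over-half {r} {s} {W} j k 1≤r r≤ r+t≤s W≤ =
  within (full j (suc k) (suc-height j k refl)) (minReach≤s , z≤n , (begin
    W                                       ≤⟨ W≤ ⟩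
    r + (halfValue j k + halfValue j k)     ≤⟨ +-monoˡ-≤ _ (≤-trans r≤ (≤-trans (n≤1+n (suc k)) (n<2^n (suc k)))) ⟩
    2 ^ suc k + (halfValue j k + halfValue j k) ≡⟨ split (2 ^ suc k) (C j) ⟨
    fullValue j (suc k)                     ∎))
  where
  open ≤-Reasoning
  split : ∀ p c → p * (2 * c + 3) ≡ p + (p * (c + 1) + p * (c + 1))
  split = solve-∀
  minReach≤s : 4 * j + 3 ≤ s
  minReach≤s = begin
    4 * j + 3                     ≡⟨ regroup j ⟩
    1 + suc (4 * j + 1)           ≤⟨ +-mono-≤ 1≤r (s≤s (+-monoʳ-≤ (4 * j) (s≤s z≤n))) ⟩
    r + suc (4 * j + suc k)       ≤⟨ r+t≤s ⟩
    s                             ∎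
    where
    regroup : ∀ j → 4 * j + 3 ≡ 1 + suc (4 * j + 1)
    regroup = solve-∀

root-over-full₂ : ∀ {r s W} j → 1 ≤ r → r ≤ 3 → r + suc (4 * j + 3) ≤ s →
  W ≤ r + (fullValue j 2 + fullValue j 2) → Bounded (suc (4 * j + 3)) s 0 W
root-over-full₂ {r} {s} {W} j 1≤r r≤3 r+t≤s W≤ =
  within (root₀ (suc j) r t≡ (s≤s z≤n) 1≤r r≤3)
    (≤-trans (≤-reflexive (trans (cong (_+ r) (sym t≡)) (+-comm (suc (4 * j + 3)) r))) r+t≤s , z≤n ,
     ≤-trans W≤ (≤-reflexive (unfold r (C j))))
  where
  t≡ : suc (4 * j + 3) ≡ 4 * suc j
  t≡ = regroup j
    where
    regroup : ∀ j → suc (4 * j + 3) ≡ 4 * suc j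
    regroup = solve-∀
  unfold : ∀ r c → r + (2 ^ 2 * (2 * c + 3) + 2 ^ 2 * (2 * c + 3)) ≡ (16 * c + 24) + r
  unfold = solve-∀

root-over-full₃ : ∀ {r s W} j → r ≤ 4 → r + suc (4 * j + 4) ≤ s →
  W ≤ r + (fullValue j 3 + fullValue j 3) → Bounded (suc (4 * j + 4)) s 0 W
root-over-full₃ {r} {s} {W} j r≤4 r+t≤s W≤ = choose (r ≤? 2) (r ≤? 3)
  where
  t≡ : suc (4 * j + 4) ≡ 4 * suc j + 1
  t≡ = regroup j
    where
    regroup : ∀ j → suc (4 * j + 4) ≡ 4 * suc j + 1
    regroup = solve-∀
  t≤s : suc (4 * j + 4) ≤ s
  t≤s = ≤-trans (m≤n+m _ r) r+t≤s
  W≤' : ∀ {q} → r ≤ q → W ≤ q + 2 * C (suc j)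
  W≤' {q} r≤q = ≤-trans W≤ (≤-trans (+-monoˡ-≤ _ r≤q) (≤-reflexive (cong (q +_) (unfold (C j)))))
    where
    unfold : ∀ c → 2 ^ 3 * (2 * c + 3) + 2 ^ 3 * (2 * c + 3) ≡ 2 * (16 * c + 24)
    unfold = solve-∀
  choose : Dec (r ≤ 2) → Dec (r ≤ 3) → Bounded (suc (4 * j + 4)) s 0 W
  choose (yes r≤2) _ = within (half (suc j) 0 t≡) (≤-trans (≤-reflexive (sym t≡)) t≤s , z≤n ,
    ≤-trans (W≤' r≤2) (≤-reflexive (unfold (C (suc j)))))
    where
    unfold : ∀ c → 2 + 2 * c ≡ 2 ^ 1 * (c + 1)
    unfold = solve-∀
  choose (no r≰2) (yes r≤3) =
    within (full (suc j) 0 t≡) (minReach≤s , z≤n , ≤-trans (W≤' r≤3) (≤-reflexive (unfold (C (suc j)))))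
    where
    unfold : ∀ c → 3 + 2 * c ≡ 2 ^ 0 * (2 * c + 3)
    unfold = solve-∀
    minReach≤s : 4 * suc j + 3 ≤ s
    minReach≤s = ≤-trans (≤-trans (m≤m+n _ 1) (≤-reflexive (regroup j))) (≤-trans (+-monoˡ-≤ _ (≰⇒> r≰2)) r+t≤s)
      where
      regroup : ∀ j → 4 * suc j + 3 + 1 ≡ 3 + suc (4 * j + 4)
      regroup = solve-∀
  choose (no _) (no r≰3) with refl ← ≤-antisym r≤4 (≰⇒> r≰3) =
    within (root₁ (suc j) t≡)
      (≤-trans (≤-reflexive (regroup j)) r+t≤s , z≤n , ≤-trans (W≤' ≤-refl) (≤-reflexive (+-comm 4 _)))
    where
    regroup : ∀ j → 4 * suc j + 5 ≡ 4 + suc (4 * j + 4)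
    regroup = solve-∀

root-over-full₄₊ : ∀ {r s W} j k → 1 ≤ r → r ≤ 5 + k → r + suc (4 * j + (5 + k)) ≤ s →
  W ≤ r + (fullValue j (4 + k) + fullValue j (4 + k)) → Bounded (suc (4 * j + (5 + k))) s 0 W
root-over-full₄₊ {r} {s} {W} j k 1≤r r≤ r+t≤s W≤ =
  within (full (suc j) (suc k) t≡) (minReach≤s , z≤n , (begin
    W                                                  ≤⟨ W≤ ⟩
    r + (fullValue j (4 + k) + fullValue j (4 + k))    ≤⟨ +-monoˡ-≤ _ (≤-trans r≤ 5+k≤) ⟩
    2 * 2 ^ k * 3 + (fullValue j (4 + k) + fullValue j (4 + k)) ≡⟨ unfold (2 ^ k) (C j) ⟩
    fullValue (suc j) (suc k)                          ∎))
  where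
  open ≤-Reasoning
  t≡ : suc (4 * j + (5 + k)) ≡ 4 * suc j + suc (suc k)
  t≡ = regroup j k
    where
    regroup : ∀ j k → suc (4 * j + (5 + k)) ≡ 4 * suc j + suc (suc k)
    regroup = solve-∀
  unfold : ∀ p c → 2 * p * 3 + (2 * (2 * (2 * (2 * p))) * (2 * c + 3) + 2 * (2 * (2 * (2 * p))) * (2 * c + 3))
                  ≡ 2 * p * (2 * (16 * c + 24) + 3)
  unfold = solve-∀
  5+k≤ : 5 + k ≤ 2 * 2 ^ k * 3
  5+k≤ = ≤-trans (≤-trans (m≤m+n (5 + k) (5 * k + 1)) (≤-reflexive (regroup k))) (*-monoˡ-≤ 3 (*-monoʳ-≤ 2 (n<2^n k)))
    where
    regroup : ∀ k → 5 + k + (5 * k + 1) ≡ 2 * suc k * 3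
    regroup = solve-∀
  minReach≤s : 4 * suc j + 3 ≤ s
  minReach≤s = ≤-trans (≤-trans (m≤m+n _ k) (≤-reflexive (regroup j k))) (≤-trans (+-monoˡ-≤ _ 1≤r) r+t≤s)
    where
    regroup : ∀ j k → 4 * suc j + 3 + k ≡ 1 + suc (4 * j + (5 + k))
    regroup = solve-∀

root-over-regular : ∀ {t r s W} (P : Profile t) → minReach P ≤ t → 1 ≤ r → r ≤ maxDepth P → r + suc t ≤ s →
  W ≤ r + (value P + value P) → Bounded (suc t) s 0 W
root-over-regular (half j k refl) _ 1≤r r≤ r+t≤s W≤ = root-over-half j k 1≤r r≤ r+t≤s W≤
root-over-regular (full j 0 refl) ρ≤t _ _ _ _ with s≤s () ← +-cancelˡ-≤ (4 * j) 3 1 ρ≤t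
root-over-regular (full j 1 refl) ρ≤t _ _ _ _ with s≤s (s≤s ()) ← +-cancelˡ-≤ (4 * j) 3 2 ρ≤t
root-over-regular (full j 2 refl) _ 1≤r r≤ r+t≤s W≤ = root-over-full₂ j 1≤r r≤ r+t≤s W≤
root-over-regular (full j 3 refl) _ _   r≤ r+t≤s W≤ = root-over-full₃ j r≤ r+t≤s W≤
root-over-regular (full j (suc (suc (suc (suc k)))) refl) _ 1≤r r≤ r+t≤s W≤ = root-over-full₄₊ j k 1≤r r≤ r+t≤s W≤
root-over-regular (root₀ _ _ _ _ _ _) _ (s≤s _) () _ _
root-over-regular (root₁ _ _)         _ (s≤s _) () _ _

height≤value : ∀ {t} (P : Profile t) → 1 ≤ maxDepth P → t ≤ value P
height≤value (half j k refl) _ = height≤halfValue j k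
height≤value (full j k refl) _ = ≤-trans (height≤halfValue j k) (halfValue≤fullValue j k)

data BelowRoot (t r w : ℕ) : Set where
  light : w ≤ t → r ≤ t ⊎ w ≡ 0 → BelowRoot t r w
  heavy : (P : Profile t) → minReach P ≤ t → r ≤ maxDepth P → w ≤ value P → BelowRoot t r w

summary⇒belowRoot : ∀ {t r s b w} → Summary t s b w → (1 ≤ s → s ≤ t) → (1 ≤ s → r ≤ b) → BelowRoot t r w
summary⇒belowRoot {s = zero} {w = w} S _ _ = light (≤-trans (≤-reflexive w≡0) z≤n) (inj₂ w≡0)
  where
  w≡0 : w ≡ 0
  w≡0 = Summary.silent⇒w≡0 S refl
summary⇒belowRoot {t} {r} {suc s} {b} {w} S s≤t r≤b with Summary.bounded S
... | single x = light (≤-trans w≤b b≤t) (inj₁ (≤-trans (r≤b (s≤s z≤n)) b≤t))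
  where
  b≤t : b ≤ t
  b≤t = Summary.active⇒b≤t S (s≤s z≤n)
  w≤b : w ≤ b
  w≤b = +-cancelʳ-≤ t w b (≤-trans x (≤-trans (+-monoˡ-≤ b (s≤t (s≤s z≤n))) (≤-reflexive (+-comm t b))))
... | within P (ρ≤s , depth , v) = heavy P (≤-trans ρ≤s (s≤t (s≤s z≤n))) (≤-trans (r≤b (s≤s z≤n)) depth) v

bounded-broadcastingRoot : ∀ {t r s w₀ w₁} → 1 ≤ r → r + suc t ≤ s → BelowRoot t r w₀ → BelowRoot t r w₁ →
  Bounded (suc t) s 0 (r + w₀ + w₁)
bounded-broadcastingRoot {t} {r} {s} {w₀} {w₁} 1≤r r+t≤s (light w₀≤t q₀) (light w₁≤t q₁) with r ≤? t
... | yes r≤t = within (half 0 t refl) (≤-trans 1≤r (≤-trans (m≤m+n r (suc t)) r+t≤s) , z≤n ,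
                  ≤-trans (+-mono-≤ (+-mono-≤ r≤t w₀≤t) w₁≤t) (3t≤halfValue₀ t))
... | no  r≰t = single (begin
  r + w₀ + w₁ + suc t   ≡⟨ cong₂ (λ a b → r + a + b + suc t) (weight≡0 q₀) (weight≡0 q₁) ⟩
  r + 0 + 0 + suc t     ≡⟨ cong (_+ suc t) (trans (+-identityʳ (r + 0)) (+-identityʳ r)) ⟩
  r + suc t             ≤⟨ r+t≤s ⟩
  s                     ≡⟨ +-identityʳ s ⟨
  s + 0                 ∎)
  where
  open ≤-Reasoning
  weight≡0 : ∀ {w} → r ≤ t ⊎ w ≡ 0 → w ≡ 0
  weight≡0 (inj₁ r≤t) = ⊥-elim (r≰t r≤t)
  weight≡0 (inj₂ w≡0) = w≡0
bounded-broadcastingRoot {r = r} {w₀ = w₀} {w₁} 1≤r r+t≤s (light w₀≤t _) (heavy P ρ≤t r≤ v₁) =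
  root-over-regular P ρ≤t 1≤r r≤ r+t≤s
    (≤-trans (≤-reflexive (+-assoc r w₀ w₁))
      (+-monoʳ-≤ r (+-mono-≤ (≤-trans w₀≤t (height≤value P (≤-trans 1≤r r≤))) v₁)))
bounded-broadcastingRoot {r = r} {w₀ = w₀} {w₁} 1≤r r+t≤s (heavy P ρ≤t r≤ v₀) (light w₁≤t _) =
  root-over-regular P ρ≤t 1≤r r≤ r+t≤s
    (≤-trans (≤-reflexive (+-assoc r w₀ w₁))
      (+-monoʳ-≤ r (+-mono-≤ v₀ (≤-trans w₁≤t (height≤value P (≤-trans 1≤r r≤))))))
bounded-broadcastingRoot {r = r} {w₀ = w₀} {w₁} 1≤r r+t≤s (heavy P₀ ρ₀≤t r≤₀ v₀) (heavy P₁ ρ₁≤t r≤₁ v₁)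
  with ≤-total (value P₀) (value P₁)
... | inj₁ v₀≤v₁ = root-over-regular P₁ ρ₁≤t 1≤r r≤₁ r+t≤s
    (≤-trans (≤-reflexive (+-assoc r w₀ w₁)) (+-monoʳ-≤ r (+-mono-≤ (≤-trans v₀ v₀≤v₁) v₁)))
... | inj₂ v₁≤v₀ = root-over-regular P₀ ρ₀≤t 1≤r r≤₀ r+t≤s
    (≤-trans (≤-reflexive (+-assoc r w₀ w₁)) (+-monoʳ-≤ r (+-mono-≤ v₀ (≤-trans v₁ v₁≤v₀))))

-- The upper bound

summary : ∀ t g → SubtreeIndependent t g → Summary t (reach t g) (minDepth t g) (subtreeWeight t g)
subtree-bounded : ∀ t g → SubtreeIndependent t g → Bounded t (reach t g) (minDepth t g) (subtreeWeight t g)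

summary t g ind = record
  { bounded    = subtree-bounded t g ind
  ; silent⇒w≡0 = reach≡0⇒subtreeWeight≡0 t g
  ; silent⇒b≡  = reach≡0⇒minDepth≡suc t g
  ; b≤suc      = minDepth≤suc t g
  ; active⇒b≤t = minDepth≤height t g
  }

subtree-bounded zero g _ with g []
... | zero  = single z≤n
... | suc n = single (≤-reflexive (sym (+-identityʳ _)))
subtree-bounded (suc t) g (cross , root , ind₀ , ind₁) = byRoot (g []) refl
  where
  -- Abstracting g [] with its equation keeps root usable: its type mentions g [].
  byRoot : ∀ n → g [] ≡ n →
    Bounded (suc t) (ownReach n (suc t) ⊔ (reach t (g ↓ false) ⊔ reach t (g ↓ true)))
                    (ifSilent n (suc (minDepth t (g ↓ false) ⊓ minDepth t (g ↓ true))))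
                    (n + subtreeWeight t (g ↓ false) + subtreeWeight t (g ↓ true))
  byRoot zero _ = bounded-silentRoot (summary t (g ↓ false) ind₀) (summary t (g ↓ true) ind₁)
    (λ p₀ p₁ → crossIndependent⇒reach≤ t g false cross p₀ p₁) (λ p₀ p₁ → crossIndependent⇒reach≤ t g true cross p₁ p₀)
  byRoot (suc n) g[]≡ = bounded-broadcastingRoot (s≤s z≤n)
    (m≤m⊔n (suc n + suc t) (reach t (g ↓ false) ⊔ reach t (g ↓ true))) (below false ind₀) (below true ind₁)
    where
    g[]>0 : 0 < g []
    g[]>0 = subst (0 <_) (sym g[]≡) (s≤s z≤n)
    below : ∀ b → SubtreeIndependent t (g ↓ b) → BelowRoot t (suc n) (subtreeWeight t (g ↓ b))
    below b ind = summary⇒belowRoot (summary t (g ↓ b) ind) (rootIndependent⇒reach≤height t g b root g[]>0)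
      (λ p → subst (_≤ minDepth t (g ↓ b)) g[]≡ (rootIndependent⇒root≤minDepth t g b root g[]>0 p))

-- Q m = (16 ^ (m + 1) − 1) / 15 = 1 + 16 + ⋯ + 16 ^ m.
Q : ℕ → ℕ
Q zero    = 1
Q (suc m) = 16 * Q m + 1

16^[m+1]≡15Q+1 : ∀ m → 16 ^ (m + 1) ≡ 15 * Q m + 1
16^[m+1]≡15Q+1 zero    = refl
16^[m+1]≡15Q+1 (suc m) = trans (cong (16 *_) (16^[m+1]≡15Q+1 m)) (unfold (Q m))
  where
  unfold : ∀ q → 16 * (15 * q + 1) ≡ 15 * (16 * q + 1) + 1
  unfold = solve-∀

[16^[m+1]∸1]/15≡Q : ∀ m → (16 ^ (m + 1) ∸ 1) / 15 ≡ Q m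
[16^[m+1]∸1]/15≡Q m = begin
  (16 ^ (m + 1) ∸ 1) / 15   ≡⟨ cong (λ n → (n ∸ 1) / 15) (16^[m+1]≡15Q+1 m) ⟩
  (15 * Q m + 1 ∸ 1) / 15   ≡⟨ cong (_/ 15) (m+n∸n≡m (15 * Q m) 1) ⟩
  (15 * Q m) / 15           ≡⟨ cong (_/ 15) (*-comm 15 (Q m)) ⟩
  (Q m * 15) / 15           ≡⟨ m*n/n≡m (Q m) 15 ⟩
  Q m                       ∎
  where open ≡-Reasoning

Q-suc : ∀ m → Q (suc m) ≡ Q m + 16 ^ suc m
Q-suc zero    = refl
Q-suc (suc m) = trans (cong (λ q → 16 * q + 1) (Q-suc m)) (distrib (Q m) (16 ^ suc m))
  where
  distrib : ∀ q p → 16 * (q + p) + 1 ≡ (16 * q + 1) + 16 * p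
  distrib = solve-∀

2C+3≡3Q : ∀ m → 2 * C m + 3 ≡ 3 * Q m
2C+3≡3Q zero    = refl
2C+3≡3Q (suc m) = trans (unfold (C m)) (trans (cong (λ x → 16 * x + 3) (2C+3≡3Q m)) (fold (Q m)))
  where
  unfold : ∀ c → 2 * (16 * c + 24) + 3 ≡ 16 * (2 * c + 3) + 3
  unfold = solve-∀
  fold : ∀ q → 16 * (3 * q) + 3 ≡ 3 * (16 * q + 1)
  fold = solve-∀

-- α m k is the claimed α_b(T_h) for h = 4 m + r with r = suc k.
α : ℕ → ℕ → ℕ
α m k = 3 * 2 ^ k * Q m + bTerm (suc k)

fullValue≤α : ∀ m k → fullValue m k ≤ α m k
fullValue≤α m k =
  ≤-trans (≤-reflexive (trans (cong (2 ^ k *_) (2C+3≡3Q m)) (reorder (2 ^ k) (Q m)))) (m≤m+n _ (bTerm (suc k)))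
  where
  reorder : ∀ p q → p * (3 * q) ≡ 3 * p * q
  reorder = solve-∀

profile≤α : ∀ m k → k ≤ 3 → (P : Profile (4 * m + suc k)) → value P ≤ α m k
profile≤α m k k≤3 (half j k' e) = ≤-trans (halfValue≤fullValue j k') (profile≤α m k k≤3 (full j k' e))
profile≤α m k k≤3 (full j k' e) =
  ≤-trans (fullValue-mono {j} {k'} {m} {k} (sym e) (blocks≤ (sym e) k≤3)) (fullValue≤α m k)
profile≤α m k k≤3 (root₀ zero f e _ _ _) with () ← m+n≡0⇒n≡0 (4 * m) e
profile≤α m k k≤3 (root₀ (suc J) f e _ _ f≤3)
  with 4*+suc-injective {m} {k} {J} {3} (trans e (4*suc≡4*+4 J)) k≤3 ≤-refl
... | refl , refl = ≤-trans (+-monoʳ-≤ (C (suc m)) f≤3)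
                      (≤-reflexive (trans (unfold (C m)) (trans (cong (λ x → 8 * x + 3) (2C+3≡3Q m)) (fold (Q m)))))
  where
  unfold : ∀ c → 16 * c + 24 + 3 ≡ 8 * (2 * c + 3) + 3
  unfold = solve-∀
  fold : ∀ q → 8 * (3 * q) + 3 ≡ 3 * 8 * q + 3
  fold = solve-∀
profile≤α m k k≤3 (root₁ J e) with 4*+suc-injective {m} {k} {J} {0} e k≤3 z≤n
... | refl , refl = ≤-reflexive (trans (sym (+-assoc (2 * C m) 3 1)) (trans (cong (_+ 1) (2C+3≡3Q m)) (fold (Q m))))
  where
  fold : ∀ q → 3 * q + 1 ≡ 3 * 1 * q + 1
  fold = solve-∀

bounded⇒≤α : ∀ m k → k ≤ 3 → ∀ {s b W} → Bounded (4 * m + suc k) s b W →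
  s ≤ (4 * m + suc k) + (4 * m + suc k) → b ≤ suc (4 * m + suc k) → W ≤ α m k
bounded⇒≤α m k k≤3 {s} {b} {W} (single x) s≤2h b≤h+1 = ≤-trans W≤2h+1 (≤-trans (2t+1≤fullValue m k) (fullValue≤α m k))
  where
  h : ℕ
  h = 4 * m + suc k
  W≤2h+1 : W ≤ suc (h + h)
  W≤2h+1 = +-cancelʳ-≤ h W (suc (h + h)) (≤-trans x (≤-trans (+-mono-≤ s≤2h b≤h+1) (≤-reflexive (+-suc (h + h) h))))
bounded⇒≤α m k k≤3 (within P (_ , _ , v)) _ _ = ≤-trans v (profile≤α m k k≤3 P)

-- The optimal broadcasts

sameResidue : ℕ → ℕ → Bool
sameResidue k (suc (suc (suc (suc d)))) = sameResidue k d
sameResidue k d                         = d ≡ᵇ k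

onLevel : ℕ → ℕ → Bool
onLevel k zero    = false
onLevel k (suc d) = sameResidue k (suc d)

levelValue : ℕ → ℕ → ℕ
levelValue k d = if onLevel k d then 3 else 0

rootValue : ℕ → ℕ
rootValue 0 = 4
rootValue 3 = 3
rootValue _ = 0

-- For h = 4 m + suc k: the root broadcasts rootValue k, and every left child false ∷ u whose
-- parent u has depth d ≥ 1 with d ≡ k (mod 4) broadcasts 3.
optimal : ℕ → List Bool → ℕ
optimal k []          = rootValue k
optimal k (false ∷ u) = levelValue k (length u)
optimal k (true ∷ u)  = 0

levelSum-length : ∀ d (g : ℕ → ℕ) → levelSum d (λ u → g (length u)) ≡ 2 ^ d * g d
levelSum-length zero    g = refl
levelSum-length (suc d) g = trans (levelSum-∷ d (λ u → g (length u)))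
  (trans (cong₂ _+_ (levelSum-length d (λ n → g (suc n))) (levelSum-length d (λ n → g (suc n))))
         (sym (doubling (2 ^ d) (g (suc d)))))

levelSum-optimal : ∀ k d → levelSum (suc d) (optimal k) ≡ 2 ^ d * levelValue k d
levelSum-optimal k d = trans (levelSum-∷ d (optimal k))
  (trans (cong₂ _+_ (levelSum-length d (levelValue k)) (trans (levelSum-length d (λ _ → 0)) (*-zeroʳ (2 ^ d))))
         (+-identityʳ _))

weight-optimal≡ : ∀ k h → weight h (optimal k) ≡ rootValue k + sumBelow h (λ d → 2 ^ d * levelValue k d)
weight-optimal≡ k h = trans (weight≡sumBelow-levelSum h (optimal k))
  (cong₂ _+_ (+-identityʳ (rootValue k)) (sumBelow-cong h (levelSum-optimal k)))

sameResidue-+4* : ∀ k m x → sameResidue k (4 * m + x) ≡ sameResidue k x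
sameResidue-+4* k zero    x = refl
sameResidue-+4* k (suc m) x = trans (cong (sameResidue k) (regroup m x)) (sameResidue-+4* k m x)
  where
  regroup : ∀ m x → 4 * suc m + x ≡ suc (suc (suc (suc (4 * m + x))))
  regroup = solve-∀

levelValue-+4* : ∀ k m y → levelValue k (4 * m + suc y) ≡ levelValue k (suc y)
levelValue-+4* k m y = cong (if_then 3 else 0) (begin
  onLevel k (4 * m + suc y)         ≡⟨ cong (onLevel k) (+-suc (4 * m) y) ⟩
  sameResidue k (suc (4 * m + y))   ≡⟨ cong (sameResidue k) (+-suc (4 * m) y) ⟨
  sameResidue k (4 * m + suc y)     ≡⟨ sameResidue-+4* k m (suc y) ⟩
  onLevel k (suc y)                 ∎)
  where open ≡-Reasoning

levelsBelow : ℕ → ℕ → ℕ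
levelsBelow k m = sumBelow (4 * m + suc k) (λ d → 2 ^ d * levelValue k d)

-- Of the four new levels 4 m + suc k + i (i < 4), only i = 3 is ≡ k (mod 4).
levelsBelow-suc : ∀ k m → k ≤ 3 → levelsBelow k (suc m) ≡ levelsBelow k m + 2 ^ k * 16 ^ suc m * 3
levelsBelow-suc k m k≤3 = begin
  levelsBelow k (suc m)
    ≡⟨ cong (λ n → sumBelow n F) (regroup m k) ⟩
  sumBelow (4 * m + suc k + 4) F
    ≡⟨ sumBelow-+-split (4 * m + suc k) 4 F ⟩
  levelsBelow k m + sumBelow 4 (λ i → F (4 * m + suc k + i))
    ≡⟨ cong (levelsBelow k m +_) (sumBelow-cong 4 (λ i → cong (2 ^ (4 * m + suc k + i) *_)
         (trans (cong (levelValue k) (+-assoc (4 * m) (suc k) i)) (levelValue-+4* k m (k + i))))) ⟩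
  levelsBelow k m + sumBelow 4 (λ i → 2 ^ (4 * m + suc k + i) * levelValue k (suc (k + i)))
    ≡⟨ cong (levelsBelow k m +_) (lastOnly k k≤3) ⟩
  levelsBelow k m + 2 ^ (4 * m + suc k + 3) * 3
    ≡⟨ cong (λ p → levelsBelow k m + p * 3) (2^ m k) ⟩
  levelsBelow k m + 2 ^ k * 16 ^ suc m * 3 ∎
  where
  open ≡-Reasoning
  F : ℕ → ℕ
  F d = 2 ^ d * levelValue k d
  regroup : ∀ m k → 4 * suc m + suc k ≡ 4 * m + suc k + 4
  regroup = solve-∀
  onlyLast : ∀ p₀ p₁ p₂ p₃ → p₀ * 0 + (p₁ * 0 + (p₂ * 0 + (p₃ * 3 + 0))) ≡ p₃ * 3
  onlyLast = solve-∀
  p : ℕ → ℕ → ℕ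
  p k i = 2 ^ (4 * m + suc k + i)
  lastOnly : ∀ k → k ≤ 3 →
    sumBelow 4 (λ i → 2 ^ (4 * m + suc k + i) * levelValue k (suc (k + i))) ≡ 2 ^ (4 * m + suc k + 3) * 3
  lastOnly 0 _ = onlyLast (p 0 0) (p 0 1) (p 0 2) (p 0 3)
  lastOnly 1 _ = onlyLast (p 1 0) (p 1 1) (p 1 2) (p 1 3)
  lastOnly 2 _ = onlyLast (p 2 0) (p 2 1) (p 2 2) (p 2 3)
  lastOnly 3 _ = onlyLast (p 3 0) (p 3 1) (p 3 2) (p 3 3)
  lastOnly (suc (suc (suc (suc _)))) (s≤s (s≤s (s≤s ())))
  2^ : ∀ m k → 2 ^ (4 * m + suc k + 3) ≡ 2 ^ k * 16 ^ suc m
  2^ m k = trans (cong (2 ^_) (regroup′ m k))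
    (trans (^-distribˡ-+-* 2 k (4 * suc m)) (cong (2 ^ k *_) (sym (^-*-assoc 2 4 (suc m)))))
    where
    regroup′ : ∀ m k → 4 * m + suc k + 3 ≡ k + 4 * suc m
    regroup′ = solve-∀

-- The level d = 0 is excluded from the levels ≡ 0 (mod 4); its 3 is made up for by the root.
levelsBelow≡ : ∀ k m → k ≤ 3 → levelsBelow k m + (if k ≡ᵇ 0 then 3 else 0) ≡ 3 * 2 ^ k * Q m
levelsBelow≡ 0 zero _ = refl
levelsBelow≡ 1 zero _ = refl
levelsBelow≡ 2 zero _ = refl
levelsBelow≡ 3 zero _ = refl
levelsBelow≡ (suc (suc (suc (suc _)))) zero (s≤s (s≤s (s≤s ())))
levelsBelow≡ k (suc m) k≤3 = begin
  levelsBelow k (suc m) + c                              ≡⟨ cong (_+ c) (levelsBelow-suc k m k≤3) ⟩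
  (levelsBelow k m + 2 ^ k * 16 ^ suc m * 3) + c          ≡⟨ swap (levelsBelow k m) c (2 ^ k) (16 ^ suc m) ⟩
  (levelsBelow k m + c) + 3 * 2 ^ k * 16 ^ suc m          ≡⟨ cong (_+ 3 * 2 ^ k * 16 ^ suc m) (levelsBelow≡ k m k≤3) ⟩
  3 * 2 ^ k * Q m + 3 * 2 ^ k * 16 ^ suc m                ≡⟨ *-distribˡ-+ (3 * 2 ^ k) (Q m) (16 ^ suc m) ⟨
  3 * 2 ^ k * (Q m + 16 ^ suc m)                          ≡⟨ cong (3 * 2 ^ k *_) (Q-suc m) ⟨
  3 * 2 ^ k * Q (suc m)                                   ∎
  where
  open ≡-Reasoning
  c : ℕ
  c = if k ≡ᵇ 0 then 3 else 0
  swap : ∀ S c p x → (S + p * x * 3) + c ≡ (S + c) + 3 * p * x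
  swap = solve-∀

weight-optimal : ∀ m k → k ≤ 3 → weight (4 * m + suc k) (optimal k) ≡ α m k
weight-optimal m k k≤3 = trans (weight-optimal≡ k (4 * m + suc k)) (byRoot k k≤3)
  where
  byRoot : ∀ k → k ≤ 3 → rootValue k + levelsBelow k m ≡ α m k
  byRoot 0 _ = trans (regroup (levelsBelow 0 m)) (cong (_+ 1) (levelsBelow≡ 0 m z≤n))
    where
    regroup : ∀ S → 4 + S ≡ (S + 3) + 1
    regroup = solve-∀
  byRoot 1 _ = trans (sym (+-identityʳ _)) (trans (levelsBelow≡ 1 m (s≤s z≤n)) (sym (+-identityʳ _)))
  byRoot 2 _ = trans (sym (+-identityʳ _)) (trans (levelsBelow≡ 2 m (s≤s (s≤s z≤n))) (sym (+-identityʳ _)))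
  byRoot 3 _ =
    trans (+-comm 3 (levelsBelow 3 m)) (cong (_+ 3) (trans (sym (+-identityʳ _)) (levelsBelow≡ 3 m ≤-refl)))
  byRoot (suc (suc (suc (suc _)))) (s≤s (s≤s (s≤s ())))

sameResidue⇒ : ∀ k a → sameResidue k a ≡ true → ∃[ i ] a ≡ 4 * i + k
sameResidue⇒ k 0 e = 0 , ≡ᵇ⇒≡ 0 k (Equivalence.from T-≡ e)
sameResidue⇒ k 1 e = 0 , ≡ᵇ⇒≡ 1 k (Equivalence.from T-≡ e)
sameResidue⇒ k 2 e = 0 , ≡ᵇ⇒≡ 2 k (Equivalence.from T-≡ e)
sameResidue⇒ k 3 e = 0 , ≡ᵇ⇒≡ 3 k (Equivalence.from T-≡ e)
sameResidue⇒ k (suc (suc (suc (suc a)))) e with sameResidue⇒ k a e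
... | i , refl = suc i , regroup i k
  where
  regroup : ∀ i k → 4 + (4 * i + k) ≡ 4 * suc i + k
  regroup = solve-∀

onLevel⇒ : ∀ k d → onLevel k d ≡ true → 1 ≤ d × ∃[ i ] d ≡ 4 * i + k
onLevel⇒ k (suc d) e = s≤s z≤n , sameResidue⇒ k (suc d) e

levelValue>0⇒ : ∀ k d → 0 < levelValue k d → onLevel k d ≡ true × levelValue k d ≡ 3
levelValue>0⇒ k d p with onLevel k d
... | true = refl , refl

levelValue≤3 : ∀ k d → levelValue k d ≤ 3
levelValue≤3 k d with onLevel k d
... | true  = ≤-refl
... | false = z≤n

levels-equal-or-4apart : ∀ k a b → onLevel k a ≡ true → onLevel k b ≡ true → a ≡ b ⊎ a + 4 ≤ b ⊎ b + 4 ≤ a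
levels-equal-or-4apart k a b ea eb with proj₂ (onLevel⇒ k a ea) | proj₂ (onLevel⇒ k b eb)
... | i , refl | i' , refl with <-cmp i i'
...   | tri≈ _ refl _ = inj₁ refl
...   | tri< i<i' _ _ = inj₂ (inj₁ (≤-trans (≤-reflexive (regroup i k)) (+-monoˡ-≤ k (*-monoʳ-≤ 4 i<i'))))
  where
  regroup : ∀ i k → 4 * i + k + 4 ≡ 4 * suc i + k
  regroup = solve-∀
...   | tri> _ _ i>i' = inj₂ (inj₂ (≤-trans (≤-reflexive (regroup i' k)) (+-monoˡ-≤ k (*-monoʳ-≤ 4 i>i'))))
  where
  regroup : ∀ i k → 4 * i + k + 4 ≡ 4 * suc i + k
  regroup = solve-∀

broadcastingRoot⇒deepLevels : ∀ k n → 0 < rootValue k → onLevel k n ≡ true → 3 ≤ n × rootValue k ≤ n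
broadcastingRoot⇒deepLevels 0 n _ e with onLevel⇒ 0 n e
... | 1≤n , zero , refl with () ← 1≤n
... | _ , suc i , refl = ≤-trans (m≤n+m 3 1) 4≤ , 4≤
  where
  4≤ : 4 ≤ 4 * suc i + 0
  4≤ = ≤-trans (*-monoʳ-≤ 4 (s≤s {0} {i} z≤n)) (m≤m+n (4 * suc i) 0)
broadcastingRoot⇒deepLevels 3 n _ e with onLevel⇒ 3 n e
... | _ , i , refl = m≤n+m 3 (4 * i) , m≤n+m 3 (4 * i)
broadcastingRoot⇒deepLevels 1 n () e
broadcastingRoot⇒deepLevels 2 n () e
broadcastingRoot⇒deepLevels (suc (suc (suc (suc _)))) n () e

parity : ℕ → Bool
parity zero    = true
parity (suc n) = not (parity n)

walk-parity : ∀ {h k u v} → Walk h k u v → parity (k + length u) ≡ parity (length v)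
walk-parity here = refl
walk-parity {k = suc k} {u = u} (step (down b p) r) = trans (cong parity (sym (+-suc k (length u)))) (walk-parity r)
walk-parity {k = suc k} (step (up {u = u} b p) r) =
  trans (cong (λ n → not (parity n)) (+-suc k (length u)))
    (trans (not-involutive (parity (k + length u))) (walk-parity r))

walk₂-sameDepth : ∀ {h} u v → Walk h 2 (false ∷ u) (false ∷ v) → length u ≡ length v → u ≡ v
walk₂-sameDepth u .(b ∷ false ∷ u) (step (down b p) (step (down .false q) here)) e =
  ⊥-elim (<-irrefl e (s≤s (n≤1+n _)))
walk₂-sameDepth u .u              (step (down b p) (step (up .b q) here))       e = refl
walk₂-sameDepth .v v              (step (up .false p) (step (down .false q) here)) e = refl
walk₂-sameDepth .(b ∷ false ∷ v) v (step (up .false p) (step (up b q) here)) e =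
  ⊥-elim (<-irrefl (sym e) (s≤s (n≤1+n _)))

-- Walks between vertices of equal depth have even length, and length 2 only joins siblings.
sameDepth-close⇒equal : ∀ {h} u v d → Walk h d (false ∷ u) (false ∷ v) → d ≤ 3 → length u ≡ length v →
  false ∷ u ≡ false ∷ v
sameDepth-close⇒equal u .u zero here _ _ = refl
sameDepth-close⇒equal u v 1 w _ e =
  ⊥-elim (not-¬ refl (sym (trans (walk-parity w) (cong (λ n → parity (suc n)) (sym e)))))
sameDepth-close⇒equal u v 2 w _ e = cong (false ∷_) (walk₂-sameDepth u v w e)
sameDepth-close⇒equal u v 3 w _ e =
  ⊥-elim (not-¬ refl (sym (trans (sym (not-involutive _)) (trans (walk-parity w) (cong (λ n → parity (suc n)) (sym e))))))
sameDepth-close⇒equal u v (suc (suc (suc (suc d)))) w (s≤s (s≤s (s≤s ()))) e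

optimal-independent : ∀ k h → IsIndependent h (optimal k)
optimal-independent k h u v _ _ fu>0 (fv>0 , d , (w , _) , d≤fv) = hears⇒≡ u v fu>0 fv>0 w d≤fv
  where
  hears⇒≡ : ∀ u v → 0 < optimal k u → 0 < optimal k v → ∀ {d} → Walk h d u v → d ≤ optimal k v → u ≡ v
  hears⇒≡ []          []           _ _ _ _ = refl
  hears⇒≡ []          (true ∷ v)   _ () _ _
  hears⇒≡ (true ∷ u)  v            () _ _ _
  hears⇒≡ (false ∷ u) (true ∷ v)   _ () _ _
  hears⇒≡ []          (false ∷ v) r>0 fv>0 {d} w d≤ with levelValue>0⇒ k (length v) fv>0
  ... | onv , fv≡3 with () ← <-irrefl refl (≤-trans (s≤s (proj₁ (broadcastingRoot⇒deepLevels k (length v) r>0 onv)))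
        (≤-trans (walk-depthʳ w) (≤-trans (≤-reflexive (+-identityʳ d)) (≤-trans d≤ (≤-reflexive fv≡3)))))
  hears⇒≡ (false ∷ u) []          fu>0 r>0 {d} w d≤ with levelValue>0⇒ k (length u) fu>0
  ... | onu , _ with () ← <-irrefl refl (≤-trans (s≤s (proj₂ (broadcastingRoot⇒deepLevels k (length u) r>0 onu)))
        (≤-trans (walk-depthˡ w) (≤-trans (≤-reflexive (+-identityʳ d)) d≤)))
  hears⇒≡ (false ∷ u) (false ∷ v) fu>0 fv>0 {d} w d≤
    with levelValue>0⇒ k (length u) fu>0 | levelValue>0⇒ k (length v) fv>0
  ... | onu , _ | onv , _ with levels-equal-or-4apart k (length u) (length v) onu onv
  ...   | inj₁ same = sameDepth-close⇒equal u v d w d≤3 same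
    where
    d≤3 : d ≤ 3
    d≤3 = ≤-trans d≤ (levelValue≤3 k (length v))
  ...   | inj₂ (inj₁ far) = ⊥-elim (<-irrefl refl (≤-trans (≤-reflexive (+-comm 4 (length u))) (≤-trans far close)))
    where
    close : length v ≤ 3 + length u
    close = ≤-pred (≤-trans (walk-depthʳ w) (≤-trans (≤-reflexive (+-suc d (length u)))
              (s≤s (+-monoˡ-≤ (length u) (≤-trans d≤ (levelValue≤3 k (length v)))))))
  ...   | inj₂ (inj₂ far) = ⊥-elim (<-irrefl refl (≤-trans (≤-reflexive (+-comm 4 (length v))) (≤-trans far close)))
    where
    close : length u ≤ 3 + length v
    close = ≤-pred (≤-trans (walk-depthˡ w) (≤-trans (≤-reflexive (+-suc d (length v)))
              (s≤s (+-monoˡ-≤ (length v) (≤-trans d≤ (levelValue≤3 k (length v)))))))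

optimal-broadcast : ∀ k h → 2 ≤ h → rootValue k ≤ h → IsBroadcast h (optimal k)
optimal-broadcast k h 2≤h r≤h [] _ = replicate h false , |replicate| , h ,
  subst (IsDist h (replicate h false) []) (length-replicate h) (dist-toRoot (replicate h false) |replicate|) , r≤h
  where
  |replicate| : IsVertex h (replicate h false)
  |replicate| = ≤-reflexive (length-replicate h)
optimal-broadcast k h _ _ (true ∷ v) iv = true ∷ v , iv , 0 , (here , λ _ _ → z≤n) , z≤n
optimal-broadcast k h _ _ (false ∷ []) iv = false ∷ [] , iv , 0 , (here , λ _ _ → z≤n) , z≤n
optimal-broadcast k h 2≤h _ (false ∷ c ∷ []) _ = false ∷ not c ∷ [] , 2≤h , 4 ,
  dist-across (false ∷ []) (false ∷ []) [] (not c) c (not-¬ refl ∘ sym) 2≤h 2≤h , ≤-trans (levelValue≤3 k 1) (n≤1+n 3)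
optimal-broadcast k h _ _ v@(false ∷ u@(_ ∷ _ ∷ _)) iv = [] , z≤n , length v , dist-fromRoot v iv ,
  ≤-trans (levelValue≤3 k (length u)) (s≤s (s≤s (s≤s z≤n)))

rootValue≤height : ∀ m k → 2 ≤ 4 * m + suc k → rootValue k ≤ 4 * m + suc k
rootValue≤height zero    0 (s≤s ())
rootValue≤height (suc m) 0 _ = ≤-trans (*-monoʳ-≤ 4 (s≤s {0} {m} z≤n)) (m≤m+n (4 * suc m) 1)
rootValue≤height m 1 _ = z≤n
rootValue≤height m 2 _ = z≤n
rootValue≤height m 3 _ = ≤-trans (n≤1+n 3) (m≤n+m 4 (4 * m))
rootValue≤height m (suc (suc (suc (suc k)))) _ = z≤n

independentBroadcast-weight≤α : ∀ m k → k ≤ 3 → ∀ f → IsIndepBroadcast (4 * m + suc k) f →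
  weight (4 * m + suc k) f ≤ α m k
independentBroadcast-weight≤α m k k≤3 f (broadcast , independent) =
  subst (_≤ α m k) (sym (weight≡subtreeWeight h f))
    (bounded⇒≤α m k k≤3 (subtree-bounded h f independentOnT) (broadcast⇒reach≤2h broadcast) (minDepth≤suc h f))
  where
  h : ℕ
  h = 4 * m + suc k
  independentOnT : SubtreeIndependent h f
  independentOnT = independent⇒subtreeIndependent independent h [] f (λ w → cong f (sym (++-identityʳ w))) ≤-refl

mainTheorem1 : ∀ (h m r : ℕ) → 2 ≤ h → 1 ≤ r → r ≤ 4 → h ≡ 4 * m + r →
    IsAlphaB h (3 * 2 ^ (r ∸ 1) * ((16 ^ (m + 1) ∸ 1) / 15) + bTerm r)
mainTheorem1 .(4 * m + suc k) m (suc k) 2≤h _ r≤4 refl = subst (IsAlphaB h) (sym α≡) (attained , maximal)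
  where
  h : ℕ
  h = 4 * m + suc k
  k≤3 : k ≤ 3
  k≤3 = ≤-pred r≤4
  α≡ : 3 * 2 ^ k * ((16 ^ (m + 1) ∸ 1) / 15) + bTerm (suc k) ≡ α m k
  α≡ = cong (λ q → 3 * 2 ^ k * q + bTerm (suc k)) ([16^[m+1]∸1]/15≡Q m)
  attained : Σ (List Bool → ℕ) λ f → IsIndepBroadcast h f × weight h f ≡ α m k
  attained = optimal k , (optimal-broadcast k h 2≤h (rootValue≤height m k 2≤h) , optimal-independent k h) ,
             weight-optimal m k k≤3
  maximal : ∀ f → IsIndepBroadcast h f → weight h f ≤ α m k
  maximal = independentBroadcast-weight≤α m k k≤3
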